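{- For every decorated tree $T$, $\phi_T(T)=\phi_I(\mathrm{I}(T))$; that is, $\phi_T=\phi_I\circ\mathrm{I}$.
   Context: $\beta$-(1,0) trees: rooted plane trees with at least one edge, a positive integer label on every node, leaves labeled $1$, root label equal to the sum of its children's labels, other internal nodes labeled between $1$ and the sum of their children's labels; $\operatorname{root}(B)$ is the root label; $B_0$ is the one-edge tree. $\Delta_{\mathcal B}(B,i)$ ($1\le i\le\operatorname{root}(B)$): attach the root of $B$ as only child of a new root, labeling both old and new root $i$. $\oplus_{\mathcal B}(B_1,i,B_2)$ ($1\le i\le\operatorname{root}(B_1)$): add the root of $B_1$ with its subtree, relabeled $i$, as new leftmost child of the root of $B_2$, and relabel the root $i+\operatorname{root}(B_2)$. $L(B)$: add a leaf as leftmost child of the root and increase the root label by $1$. Decorated trees: depth of the root is $0$, traversal order is preorder (left-to-right). A decorated tree is a rooted plane tree with at least one edge, each leaf labeled by an integer $\ge-1$, such that (1) each leaf label is strictly less than the depth of its parent; (2) every internal node of depth $p>0$ has a descendant leaf labeled $\le p-2$; (3) for every internal node $t$ of depth $p$, every subtree $T''$ rooted at a child of $t$ and every leaf $\ell$ of $T''$ labeled $p$, the leaves of $T''$ preceding $\ell$ have labels $\ge p$. Free leaves are labeled $-1$; $\operatorname{fl}(T)$ counts them. $\Pi_{\mathcal T}(T)$ (root with one child) deletes the root and subtracts $1$ from every non-free leaf label. $\phi_T$: root with a single leaf child: $B_0$; root with a single internal child: $\Delta_{\mathcal B}(\phi_T(\Pi_{\mathcal T}(T)),\operatorname{fl}(T))$;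 root with $\ge2$ children, leftmost a leaf: $L(\phi_T(T'))$ with $T'$ = $T$ without that leaf; root with $\ge2$ children, leftmost internal: with $T_{hd}$ = root + leftmost child + its subtree, $T_{tl}$ = root + other children + their subtrees, $\oplus_{\mathcal B}(\phi_T(\Pi_{\mathcal T}(T_{hd})),\operatorname{fl}(T_{hd}),\phi_T(T_{tl}))$. Dyck paths and synchronized intervals: a Dyck path of size $n$ is a word with $n$ letters $u$ and $n$ letters $d$ all of whose prefixes contain at least as many $u$ as $d$ (the empty path $\epsilon$ is the Dyck path of size $0$). A contact is a return of the path to height $0$; $c(D)$ denotes the number of non-initial contacts of $D$ ($c(\epsilon)=0$). The Tamari order on Dyck paths of size $n$ is the transitive closure of $VdD_1W\preceq VD_1dW$ for words $V,W$ and nonempty Dyck paths $D_1$. The type of a Dyck path of size $n$ is the word $w\in\{N,E\}^{n-1}$ with $w_k=E$ iff the $k$-th up step is immediately followed by an up step. A synchronized interval of order $n\ge1$ is a pair $[P,Q]$ of Dyck paths of size $n$ with $P\preceq Q$ and equal types; $\operatorname{cont}([P,Q])=c(P)$. Every nonempty Dyck path $Q$ is uniquely $uQ_1dQ_2$ with $Q_1,Q_2$ (possibly empty) Dyck paths. The map $\phi_I$ from synchronized intervals to $\beta$-(1,0) trees: write $Q=uQ_1dQ_2$ and $P=uP^\ell dR$ with $P^\ell$ a possibly empty Dyck path; let $R=P^rP_2$ with $P^r$ the prefix of $R$ such that $P^\ell P^r$ has the size of $Q_1$ (for synchronized intervals, $[P^\ell P^r,Q_1]$ and $[P_2,Q_2]$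 are synchronized intervals when nonempty). If $Q_1,Q_2$ are empty ($P=Q=ud$), $\phi_I=B_0$; if $Q_1\ne\epsilon=Q_2$, $\phi_I([P,Q])=\Delta_{\mathcal B}(\phi_I([P^\ell P^r,Q_1]),\operatorname{cont}([P,Q]))$; if $Q_1=\epsilon\ne Q_2$ (then $P=udP_2$), $\phi_I([P,Q])=L(\phi_I([P_2,Q_2]))$; if both nonempty, $\phi_I([P,Q])=\oplus_{\mathcal B}(\phi_I([P^\ell P^r,Q_1]),1+c(P^r),\phi_I([P_2,Q_2]))$. The map $\mathrm{I}$: for a non-root internal node $x$ of depth $p$ of a decorated tree, its certificate is the first leaf in traversal order among its descendants with label $\le p-2$; for a leaf $\ell$, $c(\ell)$ is the number of nodes having certificate $\ell$. In a left-to-right depth-first traversal, $\mathrm{Q}(T)$ records $u$ for each edge descended and $d$ for each edge ascended; $\mathrm{P}(T)$ records $u$ for each edge descended and $d^{c(\ell)+1}$ upon reaching each leaf $\ell$. $\mathrm{I}(T)=[\mathrm{P}(T),\mathrm{Q}(T)]$, a synchronized interval. -}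

module Defs where

open import Data.Nat using (ℕ; zero; suc; _+_; _∸_)
open import Data.Integer as ℤ using (ℤ; +_; -[1+_]; _-_)
open import Data.List using (List; []; _∷_; _++_; length; filter; replicate; take; drop)
open import Data.List.Relation.Unary.All using (All)
open import Data.List.Relation.Unary.Any using (Any)
open import Data.Maybe using (Maybe; just; nothing)
open import Data.Product using (_×_; _,_; Σ)
open import Data.Unit using (⊤)
open import Data.Empty using (⊥)
open import Relation.Binary.PropositionalEquality using (_≡_)
open import Relation.Nullary using (yes; no)

-- β-(1,0) trees (raw labelled plane trees; validity is not needed here)

data BTree : Set where
  bnode : ℕ → List BTree → BTree

root : BTree → ℕ
root (bnode n _) = n

bleaf : BTree
bleaf = bnode 1 []

B₀ : BTree
B₀ = bnode 1 (bleaf ∷ [])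

relabel : ℕ → BTree → BTree
relabel i (bnode _ cs) = bnode i cs

Δ : BTree → ℕ → BTree
Δ B i = bnode i (relabel i B ∷ [])

⊕ : BTree → ℕ → BTree → BTree
⊕ B₁ i (bnode r cs) = bnode (i + r) (relabel i B₁ ∷ cs)

L : BTree → BTree
L (bnode r cs) = bnode (suc r) (bleaf ∷ cs)

-- Plane trees with integer leaf labels (internal nodes have ≥ 1 child)

data DTree : Set where
  leaf : ℤ → DTree
  node : DTree → List DTree → DTree

-1ℤ : ℤ
-1ℤ = -[1+ 0 ]

mutual
  leaves : DTree → List ℤ
  leaves (leaf l) = l ∷ []
  leaves (node c cs) = leaves c ++ leavesL cs

  leavesL : List DTree → List ℤ
  leavesL [] = []
  leavesL (x ∷ xs) = leaves x ++ leavesL xs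

nleaves : DTree → ℕ
nleaves t = length (leaves t)

mutual
  size : DTree → ℕ
  size (leaf _) = 1
  size (node c cs) = suc (size c + sizeL cs)

  sizeL : List DTree → ℕ
  sizeL [] = 0
  sizeL (x ∷ xs) = size x + sizeL xs

Cond3 : ℤ → List ℤ → Set
Cond3 p ls = ∀ xs ys → ls ≡ xs ++ (p ∷ ys) → All (λ x → p ℤ.≤ x) xs

mutual
  -- ValidNode p t : t is an internal node of depth p satisfying
  -- conditions (1)-(3) at itself and at all its descendants.
  ValidNode : ℕ → DTree → Set
  ValidNode p (leaf _) = ⊥
  ValidNode p (node c cs) =
    ValidChild p c × ValidChildren p cs
    × (Cond2 p (node c cs))
    × All (λ ch → Cond3 (+ p) (leaves ch)) (c ∷ cs)

  Cond2 : ℕ → DTree → Set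
  Cond2 zero t = ⊤
  Cond2 (suc q) t = Any (λ l → l ℤ.≤ (+ suc q) - (+ 2)) (leaves t)

  ValidChild : ℕ → DTree → Set
  ValidChild p (leaf l) = (-1ℤ ℤ.≤ l) × (l ℤ.< + p)
  ValidChild p (node c cs) = ValidNode (suc p) (node c cs)

  ValidChildren : ℕ → List DTree → Set
  ValidChildren p [] = ⊤
  ValidChildren p (x ∷ xs) = ValidChild p x × ValidChildren p xs

IsDecorated : DTree → Set
IsDecorated t = ValidNode 0 t

fl : DTree → ℕ
fl t = length (filter (λ l → l ℤ.≟ -1ℤ) (leaves t))

decrLabel : ℤ → ℤ
decrLabel -[1+ zero ] = -[1+ zero ]
decrLabel l = l - + 1

mutual
  decr : DTree → DTree
  decr (leaf l) = leaf (decrLabel l)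
  decr (node c cs) = node (decr c) (decrL cs)

  decrL : List DTree → List DTree
  decrL [] = []
  decrL (x ∷ xs) = decr x ∷ decrL xs

Π : DTree → DTree
Π (leaf l) = leaf l            -- junk (not used)
Π (node c _) = decr c          -- applied only to roots with one child

-- φ_T with fuel; every recursive call is on a tree with fewer nodes,
-- so fuel = number of nodes suffices.  Fuel-exhausted / non-tree
-- branches return an arbitrary junk value B₀.
φT-fuel : ℕ → DTree → BTree
φT-fuel zero _ = B₀
φT-fuel (suc n) (leaf _) = B₀
φT-fuel (suc n) (node (leaf _) []) = B₀
φT-fuel (suc n) T@(node (node c cs) []) = Δ (φT-fuel n (Π T)) (fl T)
φT-fuel (suc n) (node (leaf _) (x ∷ xs)) = L (φT-fuel n (node x xs))
φT-fuel (suc n) (node (node c cs) (x ∷ xs)) =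
  let Thd = node (node c cs) []
      Ttl = node x xs
  in ⊕ (φT-fuel n (Π Thd)) (fl Thd) (φT-fuel n Ttl)

φT : DTree → BTree
φT t = φT-fuel (size t) t

data Step : Set where
  u d : Step

Path : Set
Path = List Step

-- number of non-initial contacts
contactsFrom : ℕ → Path → ℕ
contactsFrom h [] = 0
contactsFrom h (u ∷ w) = contactsFrom (suc h) w
contactsFrom zero (d ∷ w) = contactsFrom zero w        -- not a Dyck path (junk)
contactsFrom (suc zero) (d ∷ w) = suc (contactsFrom zero w)
contactsFrom (suc (suc h)) (d ∷ w) = contactsFrom (suc h) w

c : Path → ℕ
c D = contactsFrom 0 D

-- br h w : w is read after an unmatched u at relative height h;
-- returns (part before the d closing that u, part after it).
br : ℕ → Path → Path × Path
br h [] = [] , []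
br h (u ∷ w) with br (suc h) w
... | a , b = u ∷ a , b
br zero (d ∷ w) = [] , w
br (suc h) (d ∷ w) with br h w
... | a , b = d ∷ a , b

-- φ_I on pairs [P,Q] of paths, with fuel (= length of Q suffices).
-- Junk value B₀ outside the synchronized-interval domain.
φI-fuel : ℕ → Path → Path → BTree
φI-fuel zero P Q = B₀
φI-fuel (suc n) P [] = B₀
φI-fuel (suc n) P (d ∷ _) = B₀
φI-fuel (suc n) P (u ∷ Q') with br 0 Q'
... | Q₁ , Q₂ = go Q₁ Q₂
  where
    -- P = u Pˡ d R,  R = Pʳ P₂ with |Pˡ Pʳ| = |Q₁|
    Pˡ R Pʳ P₂ : Path
    Pˡ = Data.Product.proj₁ (br 0 (drop 1 P))
    R = Data.Product.proj₂ (br 0 (drop 1 P))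
    Pʳ = take (length Q₁ ∸ length Pˡ) R
    P₂ = drop (length Q₁ ∸ length Pˡ) R
    go : Path → Path → BTree
    go [] [] = B₀
    go (x ∷ xs) [] = Δ (φI-fuel n (Pˡ ++ Pʳ) (x ∷ xs)) (c P)
    go [] (y ∷ ys) = L (φI-fuel n (drop 2 P) (y ∷ ys))          -- P = u d P₂
    go (x ∷ xs) (y ∷ ys) =
      ⊕ (φI-fuel n (Pˡ ++ Pʳ) (x ∷ xs)) (1 + c Pʳ) (φI-fuel n P₂ (y ∷ ys))

φI : Path × Path → BTree
φI (P , Q) = φI-fuel (length Q) P Q

firstLe : ℤ → List ℤ → Maybe ℕ
firstLe t [] = nothing
firstLe t (l ∷ ls) with l ℤ.≤? t
... | yes _ = just 0
... | no _ with firstLe t ls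
...   | just k = just (suc k)
...   | nothing = nothing

mutual
  -- certificates (global preorder indices of leaves) of all internal nodes
  -- in the subtree t, where t sits at depth p ≥ 1 and o leaves precede it.
  certs : ℕ → ℕ → DTree → List ℕ
  certs p o (leaf _) = []
  certs p o t@(node ch chs) =
    own (firstLe ((+ p) - (+ 2)) (leaves t))
    ++ certs (suc p) o ch ++ certsL (suc p) (o + nleaves ch) chs
    where
      own : Maybe ℕ → List ℕ
      own (just k) = (o + k) ∷ []
      own nothing = []

  certsL : ℕ → ℕ → List DTree → List ℕ
  certsL p o [] = []
  certsL p o (x ∷ xs) = certs p o x ++ certsL p (o + nleaves x) xs

allCerts : DTree → List ℕ
allCerts (leaf _) = []
allCerts (node ch chs) = certs 1 0 ch ++ certsL 1 (nleaves ch) chs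

-- c(ℓ) for the k-th leaf (0-based, traversal order)
certCount : DTree → ℕ → ℕ
certCount T k = length (filter (λ x → x Data.Nat.≟ k) (allCerts T))

mutual
  Qw : DTree → Path
  Qw (leaf _) = []
  Qw (node ch chs) = (u ∷ Qw ch ++ d ∷ []) ++ QwL chs

  QwL : List DTree → Path
  QwL [] = []
  QwL (x ∷ xs) = (u ∷ Qw x ++ d ∷ []) ++ QwL xs

mutual
  -- P(T): f k = c(k-th leaf), o = number of leaves preceding the subtree
  Pw : (ℕ → ℕ) → ℕ → DTree → Path
  Pw f o (leaf _) = replicate (suc (f o)) d
  Pw f o (node ch chs) = (u ∷ Pw f o ch) ++ PwL f (o + nleaves ch) chs

  PwL : (ℕ → ℕ) → ℕ → List DTree → Path
  PwL f o [] = []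
  PwL f o (x ∷ xs) = (u ∷ Pw f o x) ++ PwL f (o + nleaves x) xs

I : DTree → Path × Path
I T = Pw (certCount T) 0 T , Qw T

-- The leaf cases are
-- immediate; the real work is the case where the leftmost child C of the root
-- is internal.  Reading P(T) leaf by leaf, it is a concatenation of blocks
-- u^(1+a_j) d^(1+c_j), where a_j counts the non-root internal nodes whose
-- leftmost leaf is j and c_j the nodes certified by j.  Each such node x gives
-- a span (first leaf of x, certificate of x), and the height of P before block
-- j is the number of spans straddling j.  For the certificate k of C, the d
-- closing the initial u of P is the extra step C adds to c_k, so
-- P(T) = u X d Y P', where X Y = P(Π C) consists of the blocks of C and X ends
-- at leaf k.  The conditions on decorated trees say exactly when a span
-- straddles a leaf: no span straddles k (label -1), hence X is a Dyck path;
-- after k the height returns to 0 precisely after the free leaves (positive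
-- labels are straddled by condition 3 and 2, labels 0 are excluded by
-- condition 3 at the root).  Since k is the first free leaf of C, this gives
-- c(Y) + 1 = fl(C), matching the label in the recursion for φI.
module Submission where

open import Defs
open import Relation.Binary.PropositionalEquality
open import Data.Nat as ℕ using (ℕ; zero; suc; _+_; _∸_; z≤n; s≤s; _≤_; _<_)
open import Data.Nat.Properties as NP using (+-suc; +-comm; +-assoc)
open import Data.Integer as ℤ using (ℤ; +_; -[1+_])
import Data.Integer.Properties as ℤP
open import Data.List using (List; []; _∷_; _++_; length; filter; replicate; take; drop; map)
open import Data.List.Properties
  using (++-assoc; ++-identityʳ; length-++; filter-++; map-++; length-map; filter-none; filter-some; filter-accept; filter-reject)
open import Data.List.Relation.Unary.All as All using (All; []; _∷_)
open import Data.List.Relation.Unary.All.Properties using (++⁺)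
open import Data.List.Relation.Unary.Any as Any using (Any; here; there)
open import Data.List.Relation.Unary.Any.Properties as AnyP using (++⁺ˡ; ++⁺ʳ)
open import Data.Maybe using (Maybe; just; nothing)
open import Data.Maybe.Properties using (just-injective)
open import Data.Product using (_×_; _,_; proj₁; proj₂; Σ)
open import Relation.Nullary using (Dec; yes; no; ¬_)
open import Relation.Nullary.Decidable using (_×-dec_)
open import Relation.Unary using (Decidable)
open import Relation.Binary.Definitions using (tri<; tri≈; tri>)
open import Data.Empty using (⊥-elim)
open import Data.Sum using (_⊎_; inj₁; inj₂)
open import Data.Unit using (tt)
open import Algebra.Properties.CommutativeSemigroup NP.+-commutativeSemigroup using (interchange)

-- Dyck paths: heights and contacts

height : ℕ → Path → Maybe ℕ
height h [] = just h
height h (u ∷ w) = height (suc h) w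
height zero (d ∷ w) = nothing
height (suc h) (d ∷ w) = height h w

height-++ : ∀ h A B h' → height h A ≡ just h' → height h (A ++ B) ≡ height h' B
height-++ h [] B h' refl = refl
height-++ h (u ∷ A) B h' e = height-++ (suc h) A B h' e
height-++ zero (d ∷ A) B h' ()
height-++ (suc h) (d ∷ A) B h' e = height-++ h A B h' e

height-lift : ∀ h A h' → height h A ≡ just h' → height (suc h) A ≡ just (suc h')
height-lift h [] h' refl = refl
height-lift h (u ∷ A) h' e = height-lift (suc h) A h' e
height-lift zero (d ∷ A) h' ()
height-lift (suc h) (d ∷ A) h' e = height-lift h A h' e

br-balanced : ∀ h A W → height h A ≡ just 0 → br h (A ++ d ∷ W) ≡ (A , W)
br-balanced zero [] W refl = refl
br-balanced (suc h) [] W ()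
br-balanced h (u ∷ A) W e rewrite br-balanced (suc h) A W e = refl
br-balanced zero (d ∷ A) W ()
br-balanced (suc h) (d ∷ A) W e rewrite br-balanced h A W e = refl

contactsFrom-++ : ∀ h A B h' → height h A ≡ just h' →
                  contactsFrom h (A ++ B) ≡ contactsFrom h A + contactsFrom h' B
contactsFrom-++ h [] B h' refl = refl
contactsFrom-++ h (u ∷ A) B h' e = contactsFrom-++ (suc h) A B h' e
contactsFrom-++ zero (d ∷ A) B h' ()
contactsFrom-++ (suc zero) (d ∷ A) B h' e = cong suc (contactsFrom-++ zero A B h' e)
contactsFrom-++ (suc (suc h)) (d ∷ A) B h' e = contactsFrom-++ (suc h) A B h' e

contactsFrom-lift : ∀ h A h' → height h A ≡ just h' → contactsFrom (suc h) A ≡ 0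
contactsFrom-lift h [] h' e = refl
contactsFrom-lift h (u ∷ A) h' e = contactsFrom-lift (suc h) A h' e
contactsFrom-lift zero (d ∷ A) h' ()
contactsFrom-lift (suc h) (d ∷ A) h' e = contactsFrom-lift h A h' e

ups : Path → ℕ
ups [] = 0
ups (u ∷ w) = suc (ups w)
ups (d ∷ w) = ups w

ups-++ : ∀ A B → ups (A ++ B) ≡ ups A + ups B
ups-++ [] B = refl
ups-++ (u ∷ A) B = cong suc (ups-++ A B)
ups-++ (d ∷ A) B = ups-++ A B

length-by-height : ∀ h A h' → height h A ≡ just h' → length A + h' ≡ ups A + ups A + h
length-by-height h [] h' refl = refl
length-by-height h (u ∷ A) h' e = begin
    suc (length A + h')           ≡⟨ cong suc (length-by-height (suc h) A h' e) ⟩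
    suc (ups A + ups A + suc h)   ≡⟨ cong suc (+-suc (ups A + ups A) h) ⟩
    suc (suc (ups A + ups A + h)) ≡⟨ cong (λ z → suc (z + h)) (sym (+-suc (ups A) (ups A))) ⟩
    suc (ups A + suc (ups A) + h) ∎
  where open ≡-Reasoning
length-by-height zero (d ∷ A) h' ()
length-by-height (suc h) (d ∷ A) h' e = trans (cong suc (length-by-height h A h' e)) (sym (+-suc (ups A + ups A) h))

height-ups : ∀ a h w → height h (replicate a u ++ w) ≡ height (a + h) w
height-ups zero h w = refl
height-ups (suc a) h w rewrite height-ups a (suc h) w | +-suc a h = refl

height-downs : ∀ b h w → height (b + h) (replicate b d ++ w) ≡ height h w
height-downs zero h w = refl
height-downs (suc b) h w = height-downs b h w

contactsFrom-ups : ∀ a h w → contactsFrom h (replicate a u ++ w) ≡ contactsFrom (a + h) w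
contactsFrom-ups zero h w = refl
contactsFrom-ups (suc a) h w rewrite contactsFrom-ups a (suc h) w | +-suc a h = refl

isGround : ℕ → ℕ
isGround zero = 1
isGround (suc _) = 0

isGround-pos : ∀ x → 0 < x → isGround x ≡ 0
isGround-pos (suc x) _ = refl

contactsFrom-downs : ∀ b h w → contactsFrom (suc b + h) (replicate (suc b) d ++ w) ≡ isGround h + contactsFrom h w
contactsFrom-downs zero zero w = refl
contactsFrom-downs zero (suc h) w = refl
contactsFrom-downs (suc b) h w = contactsFrom-downs b h w

-- Paths made of blocks

AgreeOn : ℕ → ℕ → (ℕ → ℕ) → (ℕ → ℕ) → Set
AgreeOn o n f g = ∀ j → o ≤ j → j < o + n → f j ≡ g j

<-suc-+ : ∀ {j} o n → j < suc o + n → j < o + suc n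
<-suc-+ {j} o n = subst (j <_) (sym (+-suc o n))

agreeOn-head : ∀ {o n f g} → AgreeOn o (suc n) f g → f o ≡ g o
agreeOn-head {o} r = r o NP.≤-refl (NP.m<m+n o (s≤s z≤n))

agreeOn-tail : ∀ {o n f g} → AgreeOn o (suc n) f g → AgreeOn (suc o) n f g
agreeOn-tail {o} {n} r j o<j j<n = r j (NP.<⇒≤ o<j) (<-suc-+ o n j<n)

InRange : ℕ → ℕ → ℕ → Set
InRange o n e = o ≤ e × e < o + n

inRange-left : ∀ o m n e → InRange o m e → InRange o (m + n) e
inRange-left o m n e (a , b) = a , NP.<-≤-trans b (subst (o + m ≤_) (+-assoc o m n) (NP.m≤m+n (o + m) n))

inRange-right : ∀ o m n e → InRange (o + m) n e → InRange o (m + n) e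
inRange-right o m n e (a , b) = NP.≤-trans (NP.m≤m+n o m) a , subst (e <_) (+-assoc o m n) b

agreeOn-left : ∀ o m n f g → AgreeOn o (m + n) f g → AgreeOn o m f g
agreeOn-left o m n f g r j a b = let (a' , b') = inRange-left o m n j (a , b) in r j a' b'

agreeOn-right : ∀ o m n f g → AgreeOn o (m + n) f g → AgreeOn (o + m) n f g
agreeOn-right o m n f g r j a b = let (a' , b') = inRange-right o m n j (a , b) in r j a' b'

agreeOn-cast : ∀ o n n' f g → n ≡ n' → AgreeOn o n' f g → AgreeOn o n f g
agreeOn-cast o n n' f g refl r = r

inRange-lower : ∀ {o n F} → All (InRange o n) F → All (o ≤_) F
inRange-lower [] = []
inRange-lower (p ∷ ps) = proj₁ p ∷ inRange-lower ps

inRange-upper : ∀ {o n F} → All (InRange o n) F → All (_< o + n) F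
inRange-upper [] = []
inRange-upper (p ∷ ps) = proj₂ p ∷ inRange-upper ps

block : ℕ → ℕ → Path
block a b = replicate a u ++ replicate b d

blocks : (ℕ → ℕ) → (ℕ → ℕ) → ℕ → ℕ → Path
blocks g f o zero = []
blocks g f o (suc n) = block (suc (g o)) (suc (f o)) ++ blocks g f (suc o) n

sumFrom : (ℕ → ℕ) → ℕ → ℕ → ℕ
sumFrom h o zero = 0
sumFrom h o (suc n) = h o + sumFrom h (suc o) n

-- Started at height H o, the path  blocks g f o n  is at height H j before block j.
IsProfile : (ℕ → ℕ) → (ℕ → ℕ) → (ℕ → ℕ) → ℕ → ℕ → Set
IsProfile H g f o n = AgreeOn o n (λ j → H j + g j) (λ j → H (suc j) + f j)

profile-block : ∀ (H g f : ℕ → ℕ) o n → IsProfile H g f o (suc n) → suc (g o) + H o ≡ suc (f o) + H (suc o)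
profile-block H g f o n st =
  cong suc (trans (+-comm (g o) (H o)) (trans (agreeOn-head st) (+-comm (H (suc o)) (f o))))

block-++-assoc : ∀ (a b : ℕ) (B w : Path) → (block a b ++ B) ++ w ≡ replicate a u ++ (replicate b d ++ (B ++ w))
block-++-assoc a b B w = trans (++-assoc (block a b) B w) (++-assoc (replicate a u) (replicate b d) (B ++ w))

height-blocks : ∀ (H g f : ℕ → ℕ) o n w → IsProfile H g f o n →
                height (H o) (blocks g f o n ++ w) ≡ height (H (o + n)) w
height-blocks H g f o zero w st rewrite NP.+-identityʳ o = refl
height-blocks H g f o (suc n) w st = begin
    height (H o) ((block (suc (g o)) (suc (f o)) ++ B) ++ w)
      ≡⟨ cong (height (H o)) (block-++-assoc (suc (g o)) (suc (f o)) B w) ⟩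
    height (H o) (replicate (suc (g o)) u ++ (replicate (suc (f o)) d ++ (B ++ w)))
      ≡⟨ height-ups (suc (g o)) (H o) _ ⟩
    height (suc (g o) + H o) (replicate (suc (f o)) d ++ (B ++ w))
      ≡⟨ cong (λ z → height z (replicate (suc (f o)) d ++ (B ++ w))) (profile-block H g f o n st) ⟩
    height (suc (f o) + H (suc o)) (replicate (suc (f o)) d ++ (B ++ w))
      ≡⟨ height-downs (suc (f o)) (H (suc o)) (B ++ w) ⟩
    height (H (suc o)) (B ++ w)
      ≡⟨ height-blocks H g f (suc o) n w (agreeOn-tail st) ⟩
    height (H (suc o + n)) w
      ≡⟨ cong (λ z → height (H z) w) (sym (+-suc o n)) ⟩
    height (H (o + suc n)) w ∎
  where open ≡-Reasoning
        B : Path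
        B = blocks g f (suc o) n

contactsFrom-blocks : ∀ (H g f : ℕ → ℕ) o n w → IsProfile H g f o n →
  contactsFrom (H o) (blocks g f o n ++ w) ≡ sumFrom (λ j → isGround (H (suc j))) o n + contactsFrom (H (o + n)) w
contactsFrom-blocks H g f o zero w st rewrite NP.+-identityʳ o = refl
contactsFrom-blocks H g f o (suc n) w st = begin
    contactsFrom (H o) ((block (suc (g o)) (suc (f o)) ++ B) ++ w)
      ≡⟨ cong (contactsFrom (H o)) (block-++-assoc (suc (g o)) (suc (f o)) B w) ⟩
    contactsFrom (H o) (replicate (suc (g o)) u ++ (replicate (suc (f o)) d ++ (B ++ w)))
      ≡⟨ contactsFrom-ups (suc (g o)) (H o) _ ⟩
    contactsFrom (suc (g o) + H o) (replicate (suc (f o)) d ++ (B ++ w))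
      ≡⟨ cong (λ z → contactsFrom z (replicate (suc (f o)) d ++ (B ++ w))) (profile-block H g f o n st) ⟩
    contactsFrom (suc (f o) + H (suc o)) (replicate (suc (f o)) d ++ (B ++ w))
      ≡⟨ contactsFrom-downs (f o) (H (suc o)) (B ++ w) ⟩
    G (suc o) + contactsFrom (H (suc o)) (B ++ w)
      ≡⟨ cong (_+_ (G (suc o))) (contactsFrom-blocks H g f (suc o) n w (agreeOn-tail st)) ⟩
    G (suc o) + (sumFrom (λ j → G (suc j)) (suc o) n + contactsFrom (H (suc o + n)) w)
      ≡⟨ sym (+-assoc (G (suc o)) _ _) ⟩
    G (suc o) + sumFrom (λ j → G (suc j)) (suc o) n + contactsFrom (H (suc o + n)) w
      ≡⟨ cong (λ z → G (suc o) + sumFrom (λ j → G (suc j)) (suc o) n + contactsFrom (H z) w) (sym (+-suc o n)) ⟩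
    G (suc o) + sumFrom (λ j → G (suc j)) (suc o) n + contactsFrom (H (o + suc n)) w ∎
  where open ≡-Reasoning
        B : Path
        B = blocks g f (suc o) n
        G : ℕ → ℕ
        G j = isGround (H j)

blocks-++ : ∀ g f o m n → blocks g f o (m + n) ≡ blocks g f o m ++ blocks g f (o + m) n
blocks-++ g f o zero n rewrite NP.+-identityʳ o = refl
blocks-++ g f o (suc m) n rewrite blocks-++ g f (suc o) m n | +-suc o m =
  sym (++-assoc (block (suc (g o)) (suc (f o))) (blocks g f (suc o) m) _)

blocks-cong : ∀ g g' f f' o n → AgreeOn o n g g' → AgreeOn o n f f' → blocks g f o n ≡ blocks g' f' o n
blocks-cong g g' f f' o zero eg ef = refl
blocks-cong g g' f f' o (suc n) eg ef =
  trans (cong₂ (λ x y → block (suc x) (suc y) ++ blocks g f (suc o) n) (agreeOn-head eg) (agreeOn-head ef))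
        (cong (block (suc (g' o)) (suc (f' o)) ++_) (blocks-cong g g' f f' (suc o) n (agreeOn-tail eg) (agreeOn-tail ef)))

sumFrom-cong : ∀ h h' o n → AgreeOn o n h h' → sumFrom h o n ≡ sumFrom h' o n
sumFrom-cong h h' o zero e = refl
sumFrom-cong h h' o (suc n) e = cong₂ _+_ (agreeOn-head e) (sumFrom-cong h h' (suc o) n (agreeOn-tail e))

replicate-snoc : ∀ k → replicate (suc k) d ≡ replicate k d ++ d ∷ []
replicate-snoc zero = refl
replicate-snoc (suc k) = cong (d ∷_) (replicate-snoc k)

block-snoc : ∀ a b → block a (suc b) ≡ block a b ++ d ∷ []
block-snoc a b = trans (cong (replicate a u ++_) (replicate-snoc b)) (sym (++-assoc (replicate a u) (replicate b d) (d ∷ [])))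

blocks-last-bump : ∀ g f f' o n → AgreeOn o n f' f → f' (o + n) ≡ suc (f (o + n)) →
  blocks g f' o (n + 1) ≡ blocks g f o (n + 1) ++ d ∷ []
blocks-last-bump g f f' o n r e = begin
    blocks g f' o (n + 1)                             ≡⟨ blocks-++ g f' o n 1 ⟩
    blocks g f' o n ++ (block a (suc (f' (o + n))) ++ [])
      ≡⟨ cong₂ (λ A z → A ++ (block a (suc z) ++ [])) (blocks-cong g g f' f o n (λ _ _ _ → refl) r) e ⟩
    blocks g f o n ++ (block a (suc b) ++ [])
      ≡⟨ cong (blocks g f o n ++_) (trans (++-identityʳ _) (trans (block-snoc a b) (cong (_++ d ∷ []) (sym (++-identityʳ (block a b)))))) ⟩
    blocks g f o n ++ ((block a b ++ []) ++ d ∷ [])  ≡⟨ sym (++-assoc (blocks g f o n) _ (d ∷ [])) ⟩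
    (blocks g f o n ++ (block a b ++ [])) ++ d ∷ []  ≡⟨ cong (_++ d ∷ []) (sym (blocks-++ g f o n 1)) ⟩
    blocks g f o (n + 1) ++ d ∷ [] ∎
  where open ≡-Reasoning
        a b : ℕ
        a = suc (g (o + n))
        b = suc (f (o + n))

sumFrom-suc : ∀ h o n → sumFrom h (suc o) n ≡ sumFrom (λ j → h (suc j)) o n
sumFrom-suc h o zero = refl
sumFrom-suc h o (suc n) = cong (_+_ (h (suc o))) (sumFrom-suc h (suc o) n)

-- Occurrence counts and straddling spans

occ : List ℕ → ℕ → ℕ
occ L k = length (filter (λ x → x ℕ.≟ k) L)

indicator : ∀ {P : Set} → Dec P → ℕ
indicator (yes _) = 1
indicator (no _) = 0

indicator-yes : ∀ {P : Set} (D : Dec P) → P → indicator D ≡ 1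
indicator-yes (yes _) p = refl
indicator-yes (no np) p = ⊥-elim (np p)

indicator-no : ∀ {P : Set} (D : Dec P) → ¬ P → indicator D ≡ 0
indicator-no (yes p) np = ⊥-elim (np p)
indicator-no (no _) np = refl

length-filter-∷ : ∀ {A : Set} {P : A → Set} (P? : Decidable P) x xs →
                  length (filter P? (x ∷ xs)) ≡ indicator (P? x) + length (filter P? xs)
length-filter-∷ P? x xs with P? x
... | yes _ = refl
... | no _ = refl

length-filter-++ : ∀ {A : Set} {P : A → Set} (P? : Decidable P) xs ys →
                   length (filter P? (xs ++ ys)) ≡ length (filter P? xs) + length (filter P? ys)
length-filter-++ P? xs ys rewrite filter-++ P? xs ys = length-++ (filter P? xs)

length-filter-none : ∀ {A : Set} {P : A → Set} (P? : Decidable P) {xs} → All (λ x → ¬ P x) xs →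
                     length (filter P? xs) ≡ 0
length-filter-none P? al = cong length (filter-none P? al)

occ-++ : ∀ A B k → occ (A ++ B) k ≡ occ A k + occ B k
occ-++ A B k = length-filter-++ (λ x → x ℕ.≟ k) A B

occ-∷-≡ : ∀ x L → occ (x ∷ L) x ≡ suc (occ L x)
occ-∷-≡ x L = cong length (filter-accept (λ y → y ℕ.≟ x) refl)

occ-∷-≢ : ∀ x L k → ¬ x ≡ k → occ (x ∷ L) k ≡ occ L k
occ-∷-≢ x L k ne = cong length (filter-reject (λ y → y ℕ.≟ k) ne)

occ-map-+ : ∀ s L k → occ (map (_+_ s) L) (s + k) ≡ occ L k
occ-map-+ s [] k = refl
occ-map-+ s (x ∷ L) k with x ℕ.≟ k
... | yes refl = trans (occ-∷-≡ (s + x) (map (_+_ s) L)) (trans (cong suc (occ-map-+ s L k)) (sym (occ-∷-≡ x L)))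
... | no ne = trans (occ-∷-≢ (s + x) (map (_+_ s) L) (s + k) (λ e → ne (NP.+-cancelˡ-≡ s x k e)))
                    (trans (occ-map-+ s L k) (sym (occ-∷-≢ x L k ne)))

occ-below : ∀ F j m → All (m ≤_) F → j < m → occ F j ≡ 0
occ-below [] j m [] lt = refl
occ-below (e ∷ F) j m (p ∷ ps) lt = trans (occ-∷-≢ e F j (λ eq → NP.<⇒≱ lt (subst (m ≤_) eq p))) (occ-below F j m ps lt)

occ-above : ∀ F j m → All (_< m) F → m ≤ j → occ F j ≡ 0
occ-above [] j m [] le = refl
occ-above (e ∷ F) j m (p ∷ ps) le = trans (occ-∷-≢ e F j (λ eq → NP.<⇒≱ p (subst (m ≤_) (sym eq) le))) (occ-above F j m ps le)

Straddles : ℕ → ℕ × ℕ → Set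
Straddles j pr = proj₁ pr < j × j ≤ proj₂ pr

straddles? : ∀ j → Decidable (Straddles j)
straddles? j pr = (suc (proj₁ pr) ℕ.≤? j) ×-dec (j ℕ.≤? proj₂ pr)

straddling : List (ℕ × ℕ) → ℕ → ℕ
straddling Ps j = length (filter (straddles? j) Ps)

Ordered : ℕ × ℕ → Set
Ordered pr = proj₁ pr ≤ proj₂ pr

straddling-step-pair : ∀ a b j → a ≤ b →
  indicator (straddles? j (a , b)) + indicator (a ℕ.≟ j) ≡ indicator (straddles? (suc j) (a , b)) + indicator (b ℕ.≟ j)
straddling-step-pair a b j a≤b with NP.<-cmp a j | NP.<-cmp b j
... | tri< a<j _ _ | tri< b<j _ _
  rewrite indicator-no (straddles? j (a , b)) (λ s → NP.<⇒≱ b<j (proj₂ s))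
        | indicator-no (a ℕ.≟ j) (NP.<⇒≢ a<j)
        | indicator-no (straddles? (suc j) (a , b)) (λ s → NP.<⇒≱ (NP.m≤n⇒m≤1+n b<j) (proj₂ s))
        | indicator-no (b ℕ.≟ j) (NP.<⇒≢ b<j) = refl
... | tri< a<j _ _ | tri≈ _ refl _
  rewrite indicator-yes (straddles? b (a , b)) (a<j , NP.≤-refl)
        | indicator-no (a ℕ.≟ b) (NP.<⇒≢ a<j)
        | indicator-no (straddles? (suc b) (a , b)) (λ s → NP.<-irrefl refl (proj₂ s))
        | indicator-yes (b ℕ.≟ b) refl = refl
... | tri< a<j _ _ | tri> _ _ j<b
  rewrite indicator-yes (straddles? j (a , b)) (a<j , NP.<⇒≤ j<b)
        | indicator-no (a ℕ.≟ j) (NP.<⇒≢ a<j)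
        | indicator-yes (straddles? (suc j) (a , b)) (NP.m≤n⇒m≤1+n a<j , j<b)
        | indicator-no (b ℕ.≟ j) (λ e → NP.<⇒≢ j<b (sym e)) = refl
... | tri≈ _ refl _ | tri< b<j _ _ = ⊥-elim (NP.<⇒≱ b<j a≤b)
... | tri≈ _ refl _ | tri≈ _ refl _
  rewrite indicator-no (straddles? a (a , a)) (λ s → NP.<-irrefl refl (proj₁ s))
        | indicator-yes (a ℕ.≟ a) refl
        | indicator-no (straddles? (suc a) (a , a)) (λ s → NP.<-irrefl refl (proj₂ s)) = refl
... | tri≈ _ refl _ | tri> _ _ j<b
  rewrite indicator-no (straddles? a (a , b)) (λ s → NP.<-irrefl refl (proj₁ s))
        | indicator-yes (a ℕ.≟ a) refl
        | indicator-yes (straddles? (suc a) (a , b)) (NP.≤-refl , j<b)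
        | indicator-no (b ℕ.≟ a) (λ e → NP.<⇒≢ j<b (sym e)) = refl
... | tri> _ _ j<a | _
  rewrite indicator-no (straddles? j (a , b)) (λ s → NP.<⇒≱ j<a (NP.<⇒≤ (proj₁ s)))
        | indicator-no (a ℕ.≟ j) (λ e → NP.<⇒≢ j<a (sym e))
        | indicator-no (straddles? (suc j) (a , b)) (λ s → NP.<⇒≱ j<a (NP.≤-pred (proj₁ s)))
        | indicator-no (b ℕ.≟ j) (λ e → NP.<⇒≢ (NP.<-≤-trans j<a a≤b) (sym e)) = refl

straddling-step : ∀ Ps j → All Ordered Ps →
  straddling Ps j + occ (map proj₁ Ps) j ≡ straddling Ps (suc j) + occ (map proj₂ Ps) j
straddling-step [] j [] = refl
straddling-step ((a , b) ∷ Ps) j (o ∷ os) = begin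
    straddling ((a , b) ∷ Ps) j + occ (a ∷ map proj₁ Ps) j
      ≡⟨ cong₂ _+_ (length-filter-∷ (straddles? j) (a , b) Ps) (length-filter-∷ (λ x → x ℕ.≟ j) a (map proj₁ Ps)) ⟩
    (s + S) + (a≡ + A)  ≡⟨ interchange s S a≡ A ⟩
    (s + a≡) + (S + A)  ≡⟨ cong₂ _+_ (straddling-step-pair a b j o) (straddling-step Ps j os) ⟩
    (s' + b≡) + (S' + B) ≡⟨ interchange s' b≡ S' B ⟩
    (s' + S') + (b≡ + B)
      ≡⟨ sym (cong₂ _+_ (length-filter-∷ (straddles? (suc j)) (a , b) Ps) (length-filter-∷ (λ x → x ℕ.≟ j) b (map proj₂ Ps))) ⟩
    straddling ((a , b) ∷ Ps) (suc j) + occ (b ∷ map proj₂ Ps) j ∎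
  where
    open ≡-Reasoning
    s s' a≡ b≡ S S' A B : ℕ
    s = indicator (straddles? j (a , b))
    s' = indicator (straddles? (suc j) (a , b))
    a≡ = indicator (a ℕ.≟ j)
    b≡ = indicator (b ℕ.≟ j)
    S = straddling Ps j
    S' = straddling Ps (suc j)
    A = occ (map proj₁ Ps) j
    B = occ (map proj₂ Ps) j

straddling-zero : ∀ Ps → straddling Ps 0 ≡ 0
straddling-zero Ps = length-filter-none (straddles? 0) (All.universal (λ pr s → NP.n≮0 (proj₁ s)) Ps)

nleavesL : List DTree → ℕ
nleavesL ts = length (leavesL ts)

nleaves-node : ∀ ch chs → nleaves (node ch chs) ≡ nleaves ch + nleavesL chs
nleaves-node ch chs = length-++ (leaves ch)

nleaves-pos : ∀ t → 1 ≤ nleaves t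
nleaves-pos (leaf _) = s≤s z≤n
nleaves-pos (node ch chs) = NP.≤-trans (nleaves-pos ch) (subst (nleaves ch ≤_) (sym (nleaves-node ch chs)) (NP.m≤m+n _ _))

mutual
  leaves-decr : ∀ t → leaves (decr t) ≡ map decrLabel (leaves t)
  leaves-decr (leaf l) = refl
  leaves-decr (node ch chs) rewrite leaves-decr ch | leavesL-decr chs = sym (map-++ decrLabel (leaves ch) _)

  leavesL-decr : ∀ ts → leavesL (decrL ts) ≡ map decrLabel (leavesL ts)
  leavesL-decr [] = refl
  leavesL-decr (x ∷ xs) rewrite leaves-decr x | leavesL-decr xs = sym (map-++ decrLabel (leaves x) _)

nleaves-decr : ∀ t → nleaves (decr t) ≡ nleaves t
nleaves-decr t rewrite leaves-decr t = length-map decrLabel (leaves t)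

mutual
  size-decr : ∀ t → size (decr t) ≡ size t
  size-decr (leaf _) = refl
  size-decr (node ch chs) rewrite size-decr ch | sizeL-decr chs = refl
  sizeL-decr : ∀ ts → sizeL (decrL ts) ≡ sizeL ts
  sizeL-decr [] = refl
  sizeL-decr (x ∷ xs) rewrite size-decr x | sizeL-decr xs = refl

mutual
  Qw-decr : ∀ t → Qw (decr t) ≡ Qw t
  Qw-decr (leaf _) = refl
  Qw-decr (node ch chs) rewrite Qw-decr ch | QwL-decr chs = refl
  QwL-decr : ∀ ts → QwL (decrL ts) ≡ QwL ts
  QwL-decr [] = refl
  QwL-decr (x ∷ xs) rewrite Qw-decr x | QwL-decr xs = refl

mutual
  Pw-decr : ∀ f o t → Pw f o (decr t) ≡ Pw f o t
  Pw-decr f o (leaf _) = refl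
  Pw-decr f o (node ch chs) rewrite Pw-decr f o ch | nleaves-decr ch | PwL-decr f (o + nleaves ch) chs = refl
  PwL-decr : ∀ f o ts → PwL f o (decrL ts) ≡ PwL f o ts
  PwL-decr f o [] = refl
  PwL-decr f o (x ∷ xs) rewrite Pw-decr f o x | nleaves-decr x | PwL-decr f (o + nleaves x) xs = refl

mutual
  Pw-cong : ∀ f g o t → AgreeOn o (nleaves t) f g → Pw f o t ≡ Pw g o t
  Pw-cong f g o (leaf _) r = cong (λ z → replicate (suc z) d) (agreeOn-head r)
  Pw-cong f g o (node ch chs) r =
    cong₂ (λ A B → (u ∷ A) ++ B)
      (Pw-cong f g o ch (agreeOn-left o _ _ f g r'))
      (PwL-cong f g (o + nleaves ch) chs (agreeOn-right o _ _ f g r'))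
    where r' : AgreeOn o (nleaves ch + nleavesL chs) f g
          r' = agreeOn-cast o _ _ f g (sym (nleaves-node ch chs)) r
  PwL-cong : ∀ f g o ts → AgreeOn o (nleavesL ts) f g → PwL f o ts ≡ PwL g o ts
  PwL-cong f g o [] r = refl
  PwL-cong f g o (x ∷ xs) r =
    cong₂ (λ A B → (u ∷ A) ++ B)
      (Pw-cong f g o x (agreeOn-left o _ _ f g r'))
      (PwL-cong f g (o + nleaves x) xs (agreeOn-right o _ _ f g r'))
    where r' : AgreeOn o (nleaves x + nleavesL xs) f g
          r' = agreeOn-cast o _ _ f g (sym (length-++ (leaves x))) r

mutual
  Pw-shift : ∀ f s o t → Pw f (s + o) t ≡ Pw (λ k → f (s + k)) o t
  Pw-shift f s o (leaf _) = refl
  Pw-shift f s o (node ch chs) =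
    cong₂ (λ A B → (u ∷ A) ++ B) (Pw-shift f s o ch)
      (trans (cong (λ z → PwL f z chs) (+-assoc s o (nleaves ch))) (PwL-shift f s (o + nleaves ch) chs))
  PwL-shift : ∀ f s o ts → PwL f (s + o) ts ≡ PwL (λ k → f (s + k)) o ts
  PwL-shift f s o [] = refl
  PwL-shift f s o (x ∷ xs) =
    cong₂ (λ A B → (u ∷ A) ++ B) (Pw-shift f s o x)
      (trans (cong (λ z → PwL f z xs) (+-assoc s o (nleaves x))) (PwL-shift f s (o + nleaves x) xs))

mutual
  height-Qw : ∀ h t → height h (Qw t) ≡ just h
  height-Qw h (leaf _) = refl
  height-Qw h (node ch chs) = height-QwC h ch chs
  height-QwC : ∀ h x xs → height h ((u ∷ Qw x ++ d ∷ []) ++ QwL xs) ≡ just h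
  height-QwC h x xs = trans (height-++ h (u ∷ Qw x ++ d ∷ []) (QwL xs) h
      (trans (height-++ (suc h) (Qw x) (d ∷ []) (suc h) (height-Qw (suc h) x)) refl)) (height-QwL h xs)
  height-QwL : ∀ h ts → height h (QwL ts) ≡ just h
  height-QwL h [] = refl
  height-QwL h (x ∷ xs) = height-QwC h x xs

ups-downs : ∀ k → ups (replicate k d) ≡ 0
ups-downs zero = refl
ups-downs (suc k) = ups-downs k

mutual
  ups-Pw : ∀ f o t → ups (Pw f o t) ≡ ups (Qw t)
  ups-Pw f o (leaf _) = ups-downs (suc (f o))
  ups-Pw f o (node ch chs) = ups-PwC f o ch chs
  ups-PwC : ∀ f o x xs → ups ((u ∷ Pw f o x) ++ PwL f (o + nleaves x) xs) ≡ ups ((u ∷ Qw x ++ d ∷ []) ++ QwL xs)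
  ups-PwC f o x xs rewrite ups-++ (u ∷ Pw f o x) (PwL f (o + nleaves x) xs)
     | ups-++ (u ∷ Qw x ++ d ∷ []) (QwL xs) | ups-++ (Qw x) (d ∷ [])
     | ups-Pw f o x | ups-PwL f (o + nleaves x) xs | NP.+-identityʳ (ups (Qw x)) = refl
  ups-PwL : ∀ f o ts → ups (PwL f o ts) ≡ ups (QwL ts)
  ups-PwL f o [] = refl
  ups-PwL f o (x ∷ xs) = ups-PwC f o x xs

mutual
  firstLeaves : ℕ → DTree → List ℕ
  firstLeaves o (leaf _) = []
  firstLeaves o (node ch chs) = o ∷ (firstLeaves o ch ++ firstLeavesL (o + nleaves ch) chs)
  firstLeavesL : ℕ → List DTree → List ℕ
  firstLeavesL o [] = []
  firstLeavesL o (x ∷ xs) = firstLeaves o x ++ firstLeavesL (o + nleaves x) xs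

mutual
  firstLeaves-range : ∀ o t → All (InRange o (nleaves t)) (firstLeaves o t)
  firstLeaves-range o (leaf _) = []
  firstLeaves-range o (node ch chs) =
    (NP.≤-refl , NP.m<m+n o (nleaves-pos (node ch chs))) ∷ firstLeavesC-range o ch chs
  firstLeavesC-range : ∀ o x xs → All (InRange o (nleaves (node x xs))) (firstLeaves o x ++ firstLeavesL (o + nleaves x) xs)
  firstLeavesC-range o x xs = subst (λ n → All (InRange o n) (firstLeaves o x ++ firstLeavesL (o + nleaves x) xs)) (sym (nleaves-node x xs))
    (++⁺ (All.map (λ {e} → inRange-left o _ _ e) (firstLeaves-range o x))
         (All.map (λ {e} → inRange-right o _ _ e) (firstLeavesL-range (o + nleaves x) xs)))
  firstLeavesL-range : ∀ o ts → All (InRange o (nleavesL ts)) (firstLeavesL o ts)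
  firstLeavesL-range o [] = []
  firstLeavesL-range o (x ∷ xs) = firstLeavesC-range o x xs

blocks-concat : ∀ f o n₁ n₂ F₁ F₂ A B →
  All (InRange o n₁) F₁ → All (InRange (o + n₁) n₂) F₂ →
  A ≡ blocks (occ F₁) f o n₁ → B ≡ blocks (occ F₂) f (o + n₁) n₂ →
  A ++ B ≡ blocks (occ (F₁ ++ F₂)) f o (n₁ + n₂)
blocks-concat f o n₁ n₂ F₁ F₂ A B r₁ r₂ refl refl =
  sym (trans (blocks-++ (occ (F₁ ++ F₂)) f o n₁ n₂)
    (cong₂ _++_
      (blocks-cong _ _ f f o n₁ (λ j a b → trans (occ-++ F₁ F₂ j)
           (trans (cong (λ z → occ F₁ j + z) (occ-below F₂ j (o + n₁) (inRange-lower r₂) b))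
                  (NP.+-identityʳ _))) (λ _ _ _ → refl))
      (blocks-cong _ _ f f (o + n₁) n₂ (λ j a b → trans (occ-++ F₁ F₂ j)
           (cong (λ z → z + occ F₂ j) (occ-above F₁ j (o + n₁) (inRange-upper r₁) a)))
         (λ _ _ _ → refl))))

blocks-bump : ∀ f o n F → 1 ≤ n → blocks (occ (o ∷ F)) f o n ≡ u ∷ blocks (occ F) f o n
blocks-bump f o (suc n) F _ rewrite occ-∷-≡ o F =
  cong (λ z → u ∷ block (suc (occ F o)) (suc (f o)) ++ z)
    (blocks-cong _ _ f f (suc o) n (λ j a b → occ-∷-≢ o F j (NP.<⇒≢ a)) (λ _ _ _ → refl))

mutual
  Pw-blocks : ∀ f o x → u ∷ Pw f o x ≡ blocks (occ (firstLeaves o x)) f o (nleaves x)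
  Pw-blocks f o (leaf _) = sym (++-identityʳ _)
  Pw-blocks f o (node ch chs) =
    trans (cong (u ∷_) (PwC-blocks f o ch chs))
      (trans (sym (blocks-bump f o _ (firstLeaves o ch ++ firstLeavesL (o + nleaves ch) chs) (subst (1 ≤_) (nleaves-node ch chs) (nleaves-pos (node ch chs)))))
        (cong (blocks (occ (firstLeaves o (node ch chs))) f o) (sym (nleaves-node ch chs))))
  PwC-blocks : ∀ f o x xs → (u ∷ Pw f o x) ++ PwL f (o + nleaves x) xs
      ≡ blocks (occ (firstLeaves o x ++ firstLeavesL (o + nleaves x) xs)) f o (nleaves x + nleavesL xs)
  PwC-blocks f o x xs = blocks-concat f o (nleaves x) (nleavesL xs) (firstLeaves o x) (firstLeavesL (o + nleaves x) xs) _ _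
    (firstLeaves-range o x) (firstLeavesL-range (o + nleaves x) xs) (Pw-blocks f o x) (PwL-blocks f (o + nleaves x) xs)
  PwL-blocks : ∀ f o ts → PwL f o ts ≡ blocks (occ (firstLeavesL o ts)) f o (nleavesL ts)
  PwL-blocks f o [] = refl
  PwL-blocks f o (x ∷ xs) = trans (PwC-blocks f o x xs)
    (cong (blocks (occ (firstLeavesL o (x ∷ xs))) f o) (sym (length-++ (leaves x))))

-- Certificates

-- Out-of-range indices give a junk label + 0.
at : List ℤ → ℕ → ℤ
at [] _ = + 0
at (x ∷ xs) zero = x
at (x ∷ xs) (suc i) = at xs i

at-++ˡ : ∀ xs ys i → i < length xs → at (xs ++ ys) i ≡ at xs i
at-++ˡ (x ∷ xs) ys zero lt = refl
at-++ˡ (x ∷ xs) ys (suc i) lt = at-++ˡ xs ys i (NP.≤-pred lt)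

at-++ʳ : ∀ xs ys i → at (xs ++ ys) (length xs + i) ≡ at ys i
at-++ʳ [] ys i = refl
at-++ʳ (x ∷ xs) ys i = at-++ʳ xs ys i

split-idx : ∀ n i → i < n ⊎ Σ ℕ (λ i' → i ≡ n + i')
split-idx zero i = inj₂ (i , refl)
split-idx (suc n) zero = inj₁ (s≤s z≤n)
split-idx (suc n) (suc i) with split-idx n i
... | inj₁ lt = inj₁ (s≤s lt)
... | inj₂ (i' , e) = inj₂ (i' , cong suc e)

split-at : ∀ ls i → i < length ls → ls ≡ take i ls ++ at ls i ∷ drop (suc i) ls
split-at (x ∷ ls) zero lt = refl
split-at (x ∷ ls) (suc i) lt = cong (x ∷_) (split-at ls i (NP.≤-pred lt))

All-take⇒at : ∀ {P : ℤ → Set} ls i k → All P (take i ls) → k < i → k < length ls → P (at ls k)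
All-take⇒at (x ∷ ls) (suc i) zero (p ∷ ps) lt lt' = p
All-take⇒at (x ∷ ls) (suc i) (suc k) (p ∷ ps) lt lt' = All-take⇒at ls i k ps (NP.≤-pred lt) (NP.≤-pred lt')

at⇒All-take : ∀ {P : ℤ → Set} ls k → (∀ i → i < k → i < length ls → P (at ls i)) → All P (take k ls)
at⇒All-take [] zero h = []
at⇒All-take [] (suc k) h = []
at⇒All-take (x ∷ ls) zero h = []
at⇒All-take (x ∷ ls) (suc k) h = h 0 (s≤s z≤n) (s≤s z≤n) ∷ at⇒All-take ls k (λ i a b → h (suc i) (s≤s a) (s≤s b))

All⇒at : ∀ {P : ℤ → Set} ls i → All P ls → i < length ls → P (at ls i)
All⇒at (x ∷ ls) zero (p ∷ ps) lt = p
All⇒at (x ∷ ls) (suc i) (p ∷ ps) lt = All⇒at ls i ps (NP.≤-pred lt)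

sumList : (ℤ → ℕ) → List ℤ → ℕ
sumList F [] = 0
sumList F (x ∷ xs) = F x + sumList F xs

sumFrom-at : ∀ (F : ℤ → ℕ) ls o → sumFrom (λ j → F (at ls j)) o (length ls ∸ o) ≡ sumList F (drop o ls)
sumFrom-at F [] zero = refl
sumFrom-at F (x ∷ ls) zero = cong (_+_ (F x)) (trans (sumFrom-suc (λ j → F (at (x ∷ ls) j)) 0 (length ls)) (sumFrom-at F ls zero))
sumFrom-at F [] (suc o) = refl
sumFrom-at F (x ∷ ls) (suc o) = trans (sumFrom-suc (λ j → F (at (x ∷ ls) j)) o (length ls ∸ o)) (sumFrom-at F ls o)

sumList-indicator : ∀ {P : ℤ → Set} (P? : ∀ l → Dec (P l)) xs → sumList (λ l → indicator (P? l)) xs ≡ length (filter P? xs)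
sumList-indicator P? [] = refl
sumList-indicator P? (x ∷ xs) = trans (cong (_+_ (indicator (P? x))) (sumList-indicator P? xs)) (sym (length-filter-∷ P? x xs))

firstLe-bound : ∀ t ls k → firstLe t ls ≡ just k → k < length ls
firstLe-bound t [] k ()
firstLe-bound t (l ∷ ls) k e with l ℤ.≤? t
... | yes _ rewrite sym (just-injective e) = s≤s z≤n
... | no _ with firstLe t ls in eq
...   | just k' rewrite sym (just-injective e) = s≤s (firstLe-bound t ls k' eq)
...   | nothing with () ← e

firstLe-hit : ∀ t ls k → firstLe t ls ≡ just k → at ls k ℤ.≤ t
firstLe-hit t [] k ()
firstLe-hit t (l ∷ ls) k e with l ℤ.≤? t
... | yes p rewrite sym (just-injective e) = p
... | no _ with firstLe t ls in eq
...   | just k' rewrite sym (just-injective e) = firstLe-hit t ls k' eq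
...   | nothing with () ← e

firstLe-before : ∀ t ls k i → firstLe t ls ≡ just k → i < k → ¬ (at ls i ℤ.≤ t)
firstLe-before t [] k i ()
firstLe-before t (l ∷ ls) k i e lt with l ℤ.≤? t
... | yes p rewrite sym (just-injective e) with () ← lt
... | no np with firstLe t ls in eq
...   | nothing with () ← e
firstLe-before t (l ∷ ls) k zero e lt | no np | just k' = np
firstLe-before t (l ∷ ls) k (suc i) e lt | no np | just k' rewrite sym (just-injective e) =
  firstLe-before t ls k' i eq (NP.≤-pred lt)

firstLe-any : ∀ t ls → Any (λ l → l ℤ.≤ t) ls → Σ ℕ (λ k → firstLe t ls ≡ just k)
firstLe-any t (l ∷ ls) a with l ℤ.≤? t
... | yes _ = 0 , refl
... | no np with firstLe t ls in eq
...   | just k' = suc k' , refl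
...   | nothing with a
...     | here p = ⊥-elim (np p)
...     | there a' with () ← trans (sym eq) (proj₂ (firstLe-any t ls a'))

firstLe-minimal : ∀ t ls k i → firstLe t ls ≡ just k → i < length ls → at ls i ℤ.≤ t → k ≤ i
firstLe-minimal t ls k i e lt p with NP.≤-<-connex k i
... | inj₁ le = le
... | inj₂ gt = ⊥-elim (firstLe-before t ls k i e gt p)

firstLe-map : ∀ (h : ℤ → ℤ) t t' ls → (∀ l → (l ℤ.≤ t' → h l ℤ.≤ t) × (h l ℤ.≤ t → l ℤ.≤ t')) →
          firstLe t (map h ls) ≡ firstLe t' ls
firstLe-map h t t' [] eqv = refl
firstLe-map h t t' (l ∷ ls) eqv with h l ℤ.≤? t | l ℤ.≤? t'
... | yes _ | yes _ = refl
... | yes p | no np = ⊥-elim (np (proj₂ (eqv l) p))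
... | no np | yes p = ⊥-elim (np (proj₁ (eqv l) p))
... | no _ | no _ rewrite firstLe-map h t t' ls eqv with firstLe t' ls
...   | just k = refl
...   | nothing = refl

mutual
  certs-range : ∀ p o t → All (InRange o (nleaves t)) (certs p o t)
  certs-range p o (leaf _) = []
  certs-range p o (node ch chs) with firstLe ((+ p) ℤ.- (+ 2)) (leaves (node ch chs)) in eq
  ... | just k = (NP.m≤m+n o k , NP.+-monoʳ-< o (firstLe-bound ((+ p) ℤ.- (+ 2)) (leaves (node ch chs)) k eq)) ∷ certsC-range p o ch chs
  ... | nothing = certsC-range p o ch chs
  certsC-range : ∀ p o x xs → All (InRange o (nleaves (node x xs))) (certs (suc p) o x ++ certsL (suc p) (o + nleaves x) xs)
  certsC-range p o x xs = subst (λ n → All (InRange o n) (certs (suc p) o x ++ certsL (suc p) (o + nleaves x) xs)) (sym (nleaves-node x xs))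
    (++⁺ (All.map (λ {e} → inRange-left o _ _ e) (certs-range (suc p) o x))
         (All.map (λ {e} → inRange-right o _ _ e) (certsL-range (suc p) (o + nleaves x) xs)))
  certsL-range : ∀ p o ts → All (InRange o (nleavesL ts)) (certsL p o ts)
  certsL-range p o [] = []
  certsL-range p o (x ∷ xs) = subst (λ n → All (InRange o n) (certsL p o (x ∷ xs))) (sym (length-++ (leaves x) {leavesL xs}))
      (++⁺ (All.map (λ {e} → inRange-left o _ _ e) (certs-range p o x))
         (All.map (λ {e} → inRange-right o _ _ e) (certsL-range p (o + nleaves x) xs)))

mutual
  certs-shift : ∀ p s o t → certs p (s + o) t ≡ map (_+_ s) (certs p o t)
  certs-shift p s o (leaf _) = refl
  certs-shift p s o (node ch chs) with firstLe ((+ p) ℤ.- (+ 2)) (leaves (node ch chs))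
  ... | just k = cong₂ _∷_ (+-assoc s o k) (certsC-shift p s o ch chs)
  ... | nothing = certsC-shift p s o ch chs
  certsC-shift : ∀ p s o x xs → certs (suc p) (s + o) x ++ certsL (suc p) (s + o + nleaves x) xs
                  ≡ map (_+_ s) (certs (suc p) o x ++ certsL (suc p) (o + nleaves x) xs)
  certsC-shift p s o x xs = trans (cong₂ _++_ (certs-shift (suc p) s o x)
      (trans (cong (λ z → certsL (suc p) z xs) (+-assoc s o (nleaves x))) (certsL-shift (suc p) s (o + nleaves x) xs)))
    (sym (map-++ (_+_ s) (certs (suc p) o x) _))
  certsL-shift : ∀ p s o ts → certsL p (s + o) ts ≡ map (_+_ s) (certsL p o ts)
  certsL-shift p s o [] = refl
  certsL-shift p s o (x ∷ xs) = trans (cong₂ _++_ (certs-shift p s o x)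
      (trans (cong (λ z → certsL p z xs) (+-assoc s o (nleaves x))) (certsL-shift p s (o + nleaves x) xs)))
    (sym (map-++ (_+_ s) (certs p o x) _))

decrLabel-≤-forward : ∀ q l → l ℤ.≤ + q → decrLabel l ℤ.≤ (+ suc q) ℤ.- (+ 2)
decrLabel-≤-forward zero -[1+ zero ] p = ℤ.-≤- z≤n
decrLabel-≤-forward zero -[1+ suc n ] p = ℤ.-≤- z≤n
decrLabel-≤-forward zero (+ zero) p = ℤ.-≤- z≤n
decrLabel-≤-forward zero (+ suc n) (ℤ.+≤+ ())
decrLabel-≤-forward (suc r) -[1+ zero ] p = ℤ.-≤+
decrLabel-≤-forward (suc r) -[1+ suc n ] p = ℤ.-≤+
decrLabel-≤-forward (suc r) (+ zero) p = ℤ.-≤+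
decrLabel-≤-forward (suc r) (+ suc n) (ℤ.+≤+ (s≤s le)) = ℤ.+≤+ le

decrLabel-≤-backward : ∀ q l → decrLabel l ℤ.≤ (+ suc q) ℤ.- (+ 2) → l ℤ.≤ + q
decrLabel-≤-backward q -[1+ n ] p = ℤ.-≤+
decrLabel-≤-backward q (+ zero) p = ℤ.+≤+ z≤n
decrLabel-≤-backward zero (+ suc n) ()
decrLabel-≤-backward (suc r) (+ suc n) (ℤ.+≤+ le) = ℤ.+≤+ (s≤s le)

firstLe-decr : ∀ q ls → firstLe ((+ suc q) ℤ.- (+ 2)) (map decrLabel ls) ≡ firstLe ((+ suc (suc q)) ℤ.- (+ 2)) ls
firstLe-decr q ls = firstLe-map decrLabel _ _ ls (λ l → decrLabel-≤-forward q l , decrLabel-≤-backward q l)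

-- Π lowers every depth and every non-free label by one, keeping all certificates.
mutual
  certs-decr : ∀ q o t → certs (suc (suc q)) o t ≡ certs (suc q) o (decr t)
  certs-decr q o (leaf _) = refl
  certs-decr q o (node ch chs)
    with firstLe ((+ suc (suc q)) ℤ.- (+ 2)) (leaves (node ch chs))
       | firstLe ((+ suc q) ℤ.- (+ 2)) (leaves (decr (node ch chs)))
       | trans (sym (firstLe-decr q (leaves (node ch chs)))) (cong (firstLe ((+ suc q) ℤ.- (+ 2))) (sym (leaves-decr (node ch chs))))
  ... | just k | .(just k) | refl = cong ((o + k) ∷_) (certsC-decr q o ch chs)
  ... | nothing | .nothing | refl = certsC-decr q o ch chs
  certsC-decr : ∀ q o x xs → certs (suc (suc (suc q))) o x ++ certsL (suc (suc (suc q))) (o + nleaves x) xs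
     ≡ certs (suc (suc q)) o (decr x) ++ certsL (suc (suc q)) (o + nleaves (decr x)) (decrL xs)
  certsC-decr q o x xs rewrite nleaves-decr x = cong₂ _++_ (certs-decr (suc q) o x) (certsL-decr (suc q) (o + nleaves x) xs)
  certsL-decr : ∀ q o ts → certsL (suc (suc q)) o ts ≡ certsL (suc q) o (decrL ts)
  certsL-decr q o [] = refl
  certsL-decr q o (x ∷ xs) rewrite nleaves-decr x = cong₂ _++_ (certs-decr q o x) (certsL-decr q (o + nleaves x) xs)

ownSpan : ℕ → Maybe ℕ → List (ℕ × ℕ)
ownSpan o (just k) = (o , o + k) ∷ []
ownSpan o nothing = []

-- The span (first leaf, certificate) of each internal node of t that has a
-- certificate, t being at depth p.
mutual
  spans : ℕ → ℕ → DTree → List (ℕ × ℕ)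
  spans p o (leaf _) = []
  spans p o (node ch chs) = ownSpan o (firstLe ((+ p) ℤ.- (+ 2)) (leaves (node ch chs)))
                          ++ (spans (suc p) o ch ++ spansL (suc p) (o + nleaves ch) chs)
  spansL : ℕ → ℕ → List DTree → List (ℕ × ℕ)
  spansL p o [] = []
  spansL p o (x ∷ xs) = spans p o x ++ spansL p (o + nleaves x) xs

mutual
  spans-proj₂ : ∀ p o t → map proj₂ (spans p o t) ≡ certs p o t
  spans-proj₂ p o (leaf _) = refl
  spans-proj₂ p o (node ch chs) with firstLe ((+ p) ℤ.- (+ 2)) (leaves (node ch chs))
  ... | just k = cong ((o + k) ∷_) (spansC-proj₂ p o ch chs)
  ... | nothing = spansC-proj₂ p o ch chs
  spansC-proj₂ : ∀ p o x xs → map proj₂ (spans (suc p) o x ++ spansL (suc p) (o + nleaves x) xs)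
                 ≡ certs (suc p) o x ++ certsL (suc p) (o + nleaves x) xs
  spansC-proj₂ p o x xs = trans (map-++ proj₂ (spans (suc p) o x) _)
    (cong₂ _++_ (spans-proj₂ (suc p) o x) (spansL-proj₂ (suc p) (o + nleaves x) xs))
  spansL-proj₂ : ∀ p o ts → map proj₂ (spansL p o ts) ≡ certsL p o ts
  spansL-proj₂ p o [] = refl
  spansL-proj₂ p o (x ∷ xs) = trans (map-++ proj₂ (spans p o x) _)
    (cong₂ _++_ (spans-proj₂ p o x) (spansL-proj₂ p (o + nleaves x) xs))

mutual
  spans-proj₁ : ∀ q o t → ValidChild q t → map proj₁ (spans (suc q) o t) ≡ firstLeaves o t
  spans-proj₁ q o (leaf _) v = refl
  spans-proj₁ q o (node ch chs) (vch , vchs , c2 , c3)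
    with firstLe-any ((+ suc q) ℤ.- (+ 2)) (leaves (node ch chs)) c2
  ... | k , eq rewrite eq = cong (o ∷_) (trans (map-++ proj₁ (spans (suc (suc q)) o ch) _)
        (cong₂ _++_ (spans-proj₁ (suc q) o ch vch) (spansL-proj₁ (suc q) (o + nleaves ch) chs vchs)))
  spansL-proj₁ : ∀ q o ts → ValidChildren q ts → map proj₁ (spansL (suc q) o ts) ≡ firstLeavesL o ts
  spansL-proj₁ q o [] v = refl
  spansL-proj₁ q o (x ∷ xs) (vx , vxs) = trans (map-++ proj₁ (spans (suc q) o x) _)
        (cong₂ _++_ (spans-proj₁ q o x vx) (spansL-proj₁ q (o + nleaves x) xs vxs))

SpanIn : ℕ → ℕ → ℕ × ℕ → Set
SpanIn o n pr = o ≤ proj₁ pr × proj₁ pr ≤ proj₂ pr × proj₂ pr < o + n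

spanIn-left : ∀ o m n pr → SpanIn o m pr → SpanIn o (m + n) pr
spanIn-left o m n pr (a , b , c') = a , b , proj₂ (inRange-left o m n _ (NP.≤-trans a b , c'))

spanIn-right : ∀ o m n pr → SpanIn (o + m) n pr → SpanIn o (m + n) pr
spanIn-right o m n pr (a , b , c') = proj₁ (inRange-right o m n _ (a , NP.≤-<-trans b c')) , b , proj₂ (inRange-right o m n _ (NP.≤-trans a b , c'))

mutual
  spans-range : ∀ p o t → All (SpanIn o (nleaves t)) (spans p o t)
  spans-range p o (leaf _) = []
  spans-range p o (node ch chs) with firstLe ((+ p) ℤ.- (+ 2)) (leaves (node ch chs)) in eq
  ... | just k = (NP.≤-refl , NP.m≤m+n o k , NP.+-monoʳ-< o (firstLe-bound ((+ p) ℤ.- (+ 2)) (leaves (node ch chs)) k eq))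
                 ∷ spansC-range p o ch chs
  ... | nothing = spansC-range p o ch chs
  spansC-range : ∀ p o x xs → All (SpanIn o (nleaves (node x xs))) (spans (suc p) o x ++ spansL (suc p) (o + nleaves x) xs)
  spansC-range p o x xs = subst (λ n → All (SpanIn o n) (spans (suc p) o x ++ spansL (suc p) (o + nleaves x) xs)) (sym (nleaves-node x xs))
    (++⁺ (All.map (λ {pr} → spanIn-left o _ _ pr) (spans-range (suc p) o x))
         (All.map (λ {pr} → spanIn-right o _ _ pr) (spansL-range (suc p) (o + nleaves x) xs)))
  spansL-range : ∀ p o ts → All (SpanIn o (nleavesL ts)) (spansL p o ts)
  spansL-range p o [] = []
  spansL-range p o (x ∷ xs) = subst (λ n → All (SpanIn o n) (spansL p o (x ∷ xs))) (sym (length-++ (leaves x) {leavesL xs}))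
    (++⁺ (All.map (λ {pr} → spanIn-left o _ _ pr) (spans-range p o x))
         (All.map (λ {pr} → spanIn-right o _ _ pr) (spansL-range p (o + nleaves x) xs)))

-- Which spans straddle a leaf

mutual
  labels≥-1 : ∀ p x → ValidChild p x → All (λ l → -1ℤ ℤ.≤ l) (leaves x)
  labels≥-1 p (leaf l) (a , _) = a ∷ []
  labels≥-1 p (node ch chs) (vch , vchs , _ , _) = ++⁺ (labels≥-1 (suc p) ch vch) (labels≥-1-L (suc p) chs vchs)
  labels≥-1-L : ∀ p ts → ValidChildren p ts → All (λ l → -1ℤ ℤ.≤ l) (leavesL ts)
  labels≥-1-L p [] _ = []
  labels≥-1-L p (x ∷ xs) (vx , vxs) = ++⁺ (labels≥-1 p x vx) (labels≥-1-L p xs vxs)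

≥-depth⇒¬certifies : ∀ q l → + q ℤ.≤ l → ¬ (l ℤ.≤ (+ suc q) ℤ.- (+ 2))
≥-depth⇒¬certifies zero (+ n) p ()
≥-depth⇒¬certifies (suc r) (+ n) (ℤ.+≤+ a) (ℤ.+≤+ b) = NP.<⇒≱ (s≤s b) a

<-depth⇒certifies : ∀ q l → l ℤ.< + q → l ℤ.≤ (+ suc q) ℤ.- (+ 2)
<-depth⇒certifies zero -[1+ n ] p = ℤ.-≤- z≤n
<-depth⇒certifies zero (+ n) (ℤ.+<+ ())
<-depth⇒certifies (suc r) -[1+ n ] p = ℤ.-≤+
<-depth⇒certifies (suc r) (+ n) (ℤ.+<+ (s≤s le)) = ℤ.+≤+ le

<-depth-suc : ∀ q l → l ℤ.< + q → l ℤ.< + suc q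
<-depth-suc q -[1+ n ] p = ℤ.-<+
<-depth-suc q (+ n) (ℤ.+<+ le) = ℤ.+<+ (NP.m≤n⇒m≤1+n le)

≤-1⇒<1 : ∀ l → l ℤ.≤ -1ℤ → l ℤ.< + 1
≤-1⇒<1 -[1+ n ] p = ℤ.-<+

¬straddles-below : ∀ j pr → proj₂ pr < j → ¬ Straddles j pr
¬straddles-below j pr lt s = NP.<⇒≱ lt (proj₂ s)

¬straddles-above : ∀ j pr → j ≤ proj₁ pr → ¬ Straddles j pr
¬straddles-above j pr le s = NP.<⇒≱ (proj₁ s) le

index-tail : ∀ x xs i' → nleaves x + i' < nleaves (node x xs) → i' < nleavesL xs
index-tail x xs i' lt = NP.+-cancelˡ-< (nleaves x) _ _ (subst (nleaves x + i' <_) (nleaves-node x xs) lt)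

≤-suc-assoc : ∀ o n i → o + n ≤ suc (o + (n + i))
≤-suc-assoc o n i = NP.m≤n⇒m≤1+n (subst (o + n ≤_) (+-assoc o n i) (NP.m≤m+n (o + n) i))

mutual
  spans-avoid : ∀ q o x i → ValidChild q x → i < nleaves x → at (leaves x) i ℤ.< + q →
           All (λ pr → ¬ Straddles (suc (o + i)) pr) (spans (suc q) o x)
  spans-avoid q o (leaf _) i v lt lab = []
  spans-avoid q o (node ch chs) i (vch , vchs , c2 , c3) lt lab
    with firstLe ((+ suc q) ℤ.- (+ 2)) (leaves (node ch chs)) in eq
  ... | just k = (λ s → NP.<⇒≱ (proj₂ s) (NP.+-monoʳ-≤ o (firstLe-minimal _ (leaves (node ch chs)) k i eq lt (<-depth⇒certifies q _ lab))))
                 ∷ spansC-avoid (suc q) o ch chs i (vch , vchs) lt (<-depth-suc q _ lab)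
  ... | nothing = spansC-avoid (suc q) o ch chs i (vch , vchs) lt (<-depth-suc q _ lab)

  spansC-avoid : ∀ q o x xs i → ValidChildren q (x ∷ xs) → i < nleaves (node x xs) →
           at (leaves x ++ leavesL xs) i ℤ.< + q →
           All (λ pr → ¬ Straddles (suc (o + i)) pr) (spans (suc q) o x ++ spansL (suc q) (o + nleaves x) xs)
  spansC-avoid q o x xs i (vx , vxs) lt lab with split-idx (nleaves x) i
  ... | inj₁ i< = ++⁺ (spans-avoid q o x i vx i< (subst (ℤ._< + q) (at-++ˡ (leaves x) (leavesL xs) i i<) lab))
                      (All.map (λ {pr} p → ¬straddles-above (suc (o + i)) pr
                          (NP.≤-trans (NP.+-monoʳ-< o i<) (proj₁ p)))
                        (spansL-range (suc q) (o + nleaves x) xs))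
  ... | inj₂ (i' , refl) =
      ++⁺ (All.map (λ {pr} p → ¬straddles-below (suc (o + (nleaves x + i'))) pr
               (NP.≤-trans (proj₂ (proj₂ p)) (≤-suc-assoc o (nleaves x) i')))
             (spans-range (suc q) o x))
          (subst (λ z → All (λ pr → ¬ Straddles (suc z) pr) (spansL (suc q) (o + nleaves x) xs)) (+-assoc o (nleaves x) i')
             (spansL-avoid q (o + nleaves x) xs i' vxs
               (index-tail x xs i' lt)
               (subst (ℤ._< + q) (at-++ʳ (leaves x) (leavesL xs) i') lab)))

  spansL-avoid : ∀ q o ts i → ValidChildren q ts → i < nleavesL ts → at (leavesL ts) i ℤ.< + q →
          All (λ pr → ¬ Straddles (suc (o + i)) pr) (spansL (suc q) o ts)
  spansL-avoid q o [] i v () lab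
  spansL-avoid q o (x ∷ xs) i v lt lab = spansC-avoid q o x xs i v lt lab

ownSpan-straddles : ∀ q o ch chs i → Cond2 (suc q) (node ch chs) → Cond3 (+ q) (leaves (node ch chs)) →
  i < nleaves (node ch chs) → at (leaves (node ch chs)) i ≡ + q →
  Any (Straddles (suc (o + i))) (ownSpan o (firstLe ((+ suc q) ℤ.- (+ 2)) (leaves (node ch chs))))
ownSpan-straddles q o ch chs i c2 c3 lt lab with firstLe-any ((+ suc q) ℤ.- (+ 2)) (leaves (node ch chs)) c2
... | k , eq rewrite eq = here (s≤s (NP.m≤m+n o i) , NP.+-monoʳ-< o i<k)
  where
    ls : List ℤ
    ls = leaves (node ch chs)
    i<k : i < k
    i<k with NP.<-cmp i k
    ... | tri< a _ _ = a
    ... | tri≈ _ refl _ = ⊥-elim (≥-depth⇒¬certifies q (at ls i) (subst (+ q ℤ.≤_) (sym lab) (ℤ.+≤+ NP.≤-refl)) (firstLe-hit _ ls k eq))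
    ... | tri> _ _ k<i = ⊥-elim (≥-depth⇒¬certifies q (at ls k)
            (All-take⇒at ls i k (c3 (take i ls) (drop (suc i) ls) (subst (λ z → ls ≡ take i ls ++ z ∷ drop (suc i) ls) lab (split-at ls i lt))) k<i (NP.<-trans k<i lt))
            (firstLe-hit _ ls k eq))

-- A leaf labelled m ≥ q is straddled by the span of its ancestor at depth
-- m + 1: by condition 3 no leaf up to it is labelled ≤ m - 1.
mutual
  spans-cover : ∀ q o x i m → ValidChild q x → Cond3 (+ q) (leaves x) → i < nleaves x →
          at (leaves x) i ≡ + m → q ≤ m → Any (Straddles (suc (o + i))) (spans (suc q) o x)
  spans-cover q o (leaf l) zero m (_ , l<q) c3 lt refl q≤m with l<q
  ... | ℤ.+<+ m<q = ⊥-elim (NP.<⇒≱ m<q q≤m)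
  spans-cover q o (leaf l) (suc i) m v c3 (s≤s ()) lab q≤m
  spans-cover q o (node ch chs) i m (vch , vchs , c2 , c3s) c3 lt lab q≤m with NP.m≤n⇒m<n∨m≡n q≤m
  ... | inj₂ refl = ++⁺ˡ (ownSpan-straddles q o ch chs i c2 c3 lt lab)
  ... | inj₁ q<m = ++⁺ʳ (ownSpan o (firstLe ((+ suc q) ℤ.- (+ 2)) (leaves (node ch chs))))
                        (spansC-cover (suc q) o ch chs i m (vch , vchs) c3s lt lab q<m)

  spansC-cover : ∀ q o x xs i m → ValidChildren q (x ∷ xs) → All (λ ch → Cond3 (+ q) (leaves ch)) (x ∷ xs) →
          i < nleaves (node x xs) → at (leaves x ++ leavesL xs) i ≡ + m → q ≤ m →
          Any (Straddles (suc (o + i))) (spans (suc q) o x ++ spansL (suc q) (o + nleaves x) xs)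
  spansC-cover q o x xs i m (vx , vxs) (c3x ∷ c3xs) lt lab q≤m with split-idx (nleaves x) i
  ... | inj₁ i< = ++⁺ˡ (spans-cover q o x i m vx c3x i< (trans (sym (at-++ˡ (leaves x) (leavesL xs) i i<)) lab) q≤m)
  ... | inj₂ (i' , refl) = ++⁺ʳ (spans (suc q) o x)
        (subst (λ z → Any (Straddles (suc z)) (spansL (suc q) (o + nleaves x) xs)) (+-assoc o (nleaves x) i')
          (spansL-cover q (o + nleaves x) xs i' m vxs c3xs (index-tail x xs i' lt)
             (trans (sym (at-++ʳ (leaves x) (leavesL xs) i')) lab) q≤m))

  spansL-cover : ∀ q o ts i m → ValidChildren q ts → All (λ ch → Cond3 (+ q) (leaves ch)) ts →
         i < nleavesL ts → at (leavesL ts) i ≡ + m → q ≤ m → Any (Straddles (suc (o + i))) (spansL (suc q) o ts)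
  spansL-cover q o [] i m v c3 () lab q≤m
  spansL-cover q o (x ∷ xs) i m v c3 lt lab q≤m = spansC-cover q o x xs i m v c3 lt lab q≤m

decrLabel-inverse : ∀ p l → decrLabel l ≡ + p → l ≡ + suc p
decrLabel-inverse p -[1+ zero ] ()
decrLabel-inverse p -[1+ suc n ] ()
decrLabel-inverse p (+ zero) ()
decrLabel-inverse p (+ suc n) refl = refl

decrLabel-mono : ∀ p l → + suc p ℤ.≤ l → + p ℤ.≤ decrLabel l
decrLabel-mono p (+ suc n) (ℤ.+≤+ (s≤s le)) = ℤ.+≤+ le

map-decr-split : ∀ (ls : List ℤ) xs y ys → map decrLabel ls ≡ xs ++ y ∷ ys →
  Σ (List ℤ) λ xs₀ → Σ ℤ λ y₀ → Σ (List ℤ) λ ys₀ →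
    (ls ≡ xs₀ ++ y₀ ∷ ys₀) × (decrLabel y₀ ≡ y) × (map decrLabel xs₀ ≡ xs)
map-decr-split (l ∷ ls) [] y ys e = [] , l , ls , refl , cong (λ { (a ∷ _) → a ; [] → y }) e , refl
map-decr-split (l ∷ ls) (x ∷ xs) y ys e with map-decr-split ls xs y ys (cong (λ { (_ ∷ r) → r ; [] → [] }) e)
... | xs₀ , y₀ , ys₀ , e1 , e2 , e3 =
  l ∷ xs₀ , y₀ , ys₀ , cong (l ∷_) e1 , e2 , cong₂ _∷_ (cong (λ { (a ∷ _) → a ; [] → x }) e) e3

All-map-decr : ∀ p xs₀ xs → map decrLabel xs₀ ≡ xs → All (λ x → + suc p ℤ.≤ x) xs₀ → All (λ x → + p ℤ.≤ x) xs
All-map-decr p [] [] e [] = []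
All-map-decr p (a ∷ xs₀) (x ∷ xs) e (q ∷ qs) =
  subst (λ z → + p ℤ.≤ z) (cong (λ { (a ∷ _) → a ; [] → x }) e) (decrLabel-mono p a q)
  ∷ All-map-decr p xs₀ xs (cong (λ { (_ ∷ r) → r ; [] → [] }) e) qs

Cond3-decr : ∀ p ls → Cond3 (+ suc p) ls → Cond3 (+ p) (map decrLabel ls)
Cond3-decr p ls c3 xs ys e with map-decr-split ls xs (+ p) ys e
... | xs₀ , y₀ , ys₀ , e1 , e2 , e3 rewrite decrLabel-inverse p y₀ e2 = All-map-decr p xs₀ xs e3 (c3 xs₀ ys₀ e1)

Cond2-decr : ∀ p t → Cond2 (suc p) t → Cond2 p (decr t)
Cond2-decr zero t c = tt
Cond2-decr (suc r) t c = subst (Any (λ l → l ℤ.≤ (+ suc r) ℤ.- (+ 2))) (sym (leaves-decr t))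
  (AnyP.map⁺ (Any.map (λ {l} → decrLabel-≤-forward r l) c))

Cond3-all-decr : ∀ p ts → All (λ ch → Cond3 (+ suc p) (leaves ch)) ts → All (λ ch → Cond3 (+ p) (leaves ch)) (map decr ts)
Cond3-all-decr p [] [] = []
Cond3-all-decr p (t ∷ ts) (c ∷ cs) =
  subst (Cond3 (+ p)) (sym (leaves-decr t)) (Cond3-decr p (leaves t) c) ∷ Cond3-all-decr p ts cs

map-decr : ∀ ts → map decr ts ≡ decrL ts
map-decr [] = refl
map-decr (x ∷ xs) = cong (decr x ∷_) (map-decr xs)

mutual
  ValidChild-decr : ∀ p x → ValidChild (suc p) x → ValidChild p (decr x)
  ValidChild-decr p (leaf -[1+ zero ]) (a , b) = a , ℤ.-<+
  ValidChild-decr p (leaf -[1+ suc n ]) (ℤ.-≤- () , b)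
  ValidChild-decr p (leaf (+ zero)) (a , b) = ℤ.-≤- z≤n , ℤ.-<+
  ValidChild-decr p (leaf (+ suc n)) (a , ℤ.+<+ (s≤s lt)) = ℤ.-≤+ , ℤ.+<+ lt
  ValidChild-decr p (node ch chs) v = ValidNode-decr (suc p) ch chs v

  ValidNode-decr : ∀ p ch chs → ValidNode (suc p) (node ch chs) → ValidNode p (decr (node ch chs))
  ValidNode-decr p ch chs (vch , vchs , c2 , c3s) =
    ValidChild-decr p ch vch , ValidChildren-decr p chs vchs , Cond2-decr p (node ch chs) c2 ,
    subst (All (λ c → Cond3 (+ p) (leaves c))) (cong (decr ch ∷_) (map-decr chs)) (Cond3-all-decr p (ch ∷ chs) c3s)

  ValidChildren-decr : ∀ p ts → ValidChildren (suc p) ts → ValidChildren p (decrL ts)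
  ValidChildren-decr p [] _ = tt
  ValidChildren-decr p (x ∷ xs) (vx , vxs) = ValidChild-decr p x vx , ValidChildren-decr p xs vxs

-- The body of φI-fuel (suc n) P (u ∷ Q) with Q = Q₁ d Q₂ and P = u A d B.
φI-step : ℕ → Path → Path → Path → Path → Path → BTree
φI-step n P A B [] [] = B₀
φI-step n P A B (x ∷ xs) [] = Δ (φI-fuel n (A ++ take (length (x ∷ xs) ∸ length A) B) (x ∷ xs)) (c P)
φI-step n P A B [] (y ∷ ys) = L (φI-fuel n (drop 2 P) (y ∷ ys))
φI-step n P A B (x ∷ xs) (y ∷ ys) =
  ⊕ (φI-fuel n (A ++ take (length (x ∷ xs) ∸ length A) B) (x ∷ xs))
    (1 + c (take (length (x ∷ xs) ∸ length A) B))
    (φI-fuel n (drop (length (x ∷ xs) ∸ length A) B) (y ∷ ys))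

φI-unfold : ∀ n P Q' Q₁ Q₂ → br 0 Q' ≡ (Q₁ , Q₂) →
  φI-fuel (suc n) P (u ∷ Q') ≡ φI-step n P (proj₁ (br 0 (drop 1 P))) (proj₂ (br 0 (drop 1 P))) Q₁ Q₂
φI-unfold n P Q' [] [] eq rewrite eq = refl
φI-unfold n P Q' (x ∷ xs) [] eq rewrite eq = refl
φI-unfold n P Q' [] (y ∷ ys) eq rewrite eq = refl
φI-unfold n P Q' (x ∷ xs) (y ∷ ys) eq rewrite eq = refl

length-br : ∀ h w → length (proj₁ (br h w)) + length (proj₂ (br h w)) ≤ length w
length-br h [] = z≤n
length-br h (u ∷ w) with br (suc h) w | length-br (suc h) w
... | a , b | ih = s≤s ih
length-br zero (d ∷ w) = NP.n≤1+n _
length-br (suc h) (d ∷ w) with br h w | length-br h w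
... | a , b | ih = s≤s ih

length-br₁ : ∀ h w {k} → length w ≤ k → length (proj₁ (br h w)) ≤ k
length-br₁ h w le = NP.≤-trans (NP.≤-trans (NP.m≤m+n _ _) (length-br h w)) le

length-br₂ : ∀ h w {k} → length w ≤ k → length (proj₂ (br h w)) ≤ k
length-br₂ h w le = NP.≤-trans (NP.≤-trans (NP.m≤n+m _ _) (length-br h w)) le

φI-fuel-irrelevant : ∀ n m P Q → length Q ≤ n → length Q ≤ m → φI-fuel n P Q ≡ φI-fuel m P Q
φI-fuel-irrelevant zero zero P Q ln lm = refl
φI-fuel-irrelevant zero (suc m) P [] ln lm = refl
φI-fuel-irrelevant (suc n) zero P [] ln lm = refl
φI-fuel-irrelevant (suc n) (suc m) P [] ln lm = refl
φI-fuel-irrelevant (suc n) (suc m) P (d ∷ Q) ln lm = refl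
φI-fuel-irrelevant (suc n) (suc m) P (u ∷ Q') (s≤s ln) (s≤s lm) =
  trans (φI-unfold n P Q' Q₁ Q₂ refl)
    (trans (go Q₁ Q₂ (length-br₁ 0 Q' ln) (length-br₁ 0 Q' lm) (length-br₂ 0 Q' ln) (length-br₂ 0 Q' lm))
      (sym (φI-unfold m P Q' Q₁ Q₂ refl)))
  where
    Q₁ Q₂ A B : Path
    Q₁ = proj₁ (br 0 Q')
    Q₂ = proj₂ (br 0 Q')
    A = proj₁ (br 0 (drop 1 P))
    B = proj₂ (br 0 (drop 1 P))
    go : ∀ R₁ R₂ → length R₁ ≤ n → length R₁ ≤ m → length R₂ ≤ n → length R₂ ≤ m →
         φI-step n P A B R₁ R₂ ≡ φI-step m P A B R₁ R₂
    go [] [] _ _ _ _ = refl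
    go (x ∷ xs) [] a b _ _ = cong (λ z → Δ z (c P)) (φI-fuel-irrelevant n m _ (x ∷ xs) a b)
    go [] (y ∷ ys) _ _ a b = cong L (φI-fuel-irrelevant n m _ (y ∷ ys) a b)
    go (x ∷ xs) (y ∷ ys) a b a' b' =
      cong₂ (λ z w → ⊕ z (1 + c (take (length (x ∷ xs) ∸ length A) B)) w)
        (φI-fuel-irrelevant n m _ (x ∷ xs) a b) (φI-fuel-irrelevant n m _ (y ∷ ys) a' b')

decr-head-bound : ∀ c cs rest {k} → size (node c cs) + sizeL rest ≤ k → size (decr (node c cs)) ≤ k
decr-head-bound c cs rest {k} le = subst (_≤ k) (sym (size-decr (node c cs))) (NP.≤-trans (NP.m≤m+n _ _) le)

size-pos : ∀ t → 1 ≤ size t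
size-pos (leaf _) = s≤s z≤n
size-pos (node _ _) = s≤s z≤n

tail-bound : ∀ C x xs {k} → size C + (size x + sizeL xs) ≤ k → size (node x xs) ≤ k
tail-bound C x xs le = NP.≤-trans (NP.+-monoˡ-≤ (size x + sizeL xs) (size-pos C)) le

φT-fuel-irrelevant : ∀ n m t → size t ≤ n → size t ≤ m → φT-fuel n t ≡ φT-fuel m t
φT-fuel-irrelevant (suc n) (suc m) (leaf _) _ _ = refl
φT-fuel-irrelevant (suc n) (suc m) (node (leaf _) []) _ _ = refl
φT-fuel-irrelevant (suc n) (suc m) (node (node c cs) []) (s≤s ln) (s≤s lm) =
  cong (λ z → Δ z (fl (node (node c cs) [])))
    (φT-fuel-irrelevant n m _ (decr-head-bound c cs [] ln) (decr-head-bound c cs [] lm))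
φT-fuel-irrelevant (suc n) (suc m) (node (leaf _) (x ∷ xs)) (s≤s ln) (s≤s lm) =
  cong L (φT-fuel-irrelevant n m (node x xs) ln lm)
φT-fuel-irrelevant (suc n) (suc m) (node (node c cs) (x ∷ xs)) (s≤s ln) (s≤s lm) =
  cong₂ (λ z w → ⊕ z (fl (node (node c cs) [])) w)
    (φT-fuel-irrelevant n m _ (decr-head-bound c cs (x ∷ xs) ln) (decr-head-bound c cs (x ∷ xs) lm))
    (φT-fuel-irrelevant n m (node x xs) (tail-bound (node c cs) x xs ln) (tail-bound (node c cs) x xs lm))

φT-single-child : ∀ c cs → φT (node (node c cs) []) ≡ Δ (φT (decr (node c cs))) (fl (node (node c cs) []))
φT-single-child c cs =
  cong (λ z → Δ z (fl (node (node c cs) []))) (φT-fuel-irrelevant _ _ (decr (node c cs)) (decr-head-bound c cs [] NP.≤-refl) NP.≤-refl)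

φT-internal-first : ∀ c cs x xs →
  φT (node (node c cs) (x ∷ xs)) ≡ ⊕ (φT (decr (node c cs))) (fl (node (node c cs) [])) (φT (node x xs))
φT-internal-first c cs x xs =
  cong₂ (λ z w → ⊕ z (fl (node (node c cs) [])) w)
    (φT-fuel-irrelevant _ _ (decr (node c cs)) (decr-head-bound c cs (x ∷ xs) NP.≤-refl) NP.≤-refl)
    (φT-fuel-irrelevant _ _ (node x xs) (tail-bound (node c cs) x xs NP.≤-refl) NP.≤-refl)

take-length-++ : ∀ (Y Z : Path) → take (length Y) (Y ++ Z) ≡ Y
take-length-++ [] Z = refl
take-length-++ (y ∷ Y) Z = cong (y ∷_) (take-length-++ Y Z)

drop-length-++ : ∀ (Y Z : Path) → drop (length Y) (Y ++ Z) ≡ Z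
drop-length-++ [] Z = refl
drop-length-++ (y ∷ Y) Z = drop-length-++ Y Z

Qw-node : ∀ C rest → Qw (node C rest) ≡ u ∷ (Qw C ++ d ∷ QwL rest)
Qw-node C rest = cong (u ∷_) (++-assoc (Qw C) (d ∷ []) (QwL rest))

φI-at : ∀ P Q Q' → Q ≡ u ∷ Q' → φI (P , Q) ≡ φI-fuel (suc (length Q')) P (u ∷ Q')
φI-at P Q Q' refl = refl

PwL-restrict : ∀ Z s ts → All (λ e → e < s) Z →
  PwL (occ (Z ++ certsL 1 s ts)) s ts ≡ PwL (occ (certsL 1 0 ts)) 0 ts
PwL-restrict Z s ts al = begin
    PwL F s ts ≡⟨ cong (λ z → PwL F z ts) (sym (NP.+-identityʳ s)) ⟩
    PwL F (s + 0) ts ≡⟨ PwL-shift F s 0 ts ⟩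
    PwL (λ k → F (s + k)) 0 ts ≡⟨ PwL-cong _ _ 0 ts (λ k _ _ → ext k) ⟩
    PwL (occ (certsL 1 0 ts)) 0 ts ∎
  where
    open ≡-Reasoning
    F : ℕ → ℕ
    F = occ (Z ++ certsL 1 s ts)
    ext : ∀ k → F (s + k) ≡ occ (certsL 1 0 ts) k
    ext k = begin
      occ (Z ++ certsL 1 s ts) (s + k) ≡⟨ occ-++ Z _ (s + k) ⟩
      occ Z (s + k) + occ (certsL 1 s ts) (s + k)
        ≡⟨ cong₂ _+_ (occ-above Z (s + k) s al (NP.m≤m+n s k))
                     (cong (λ L → occ L (s + k)) (trans (cong (λ z → certsL 1 z ts) (sym (NP.+-identityʳ s))) (certsL-shift 1 s 0 ts))) ⟩
      occ (map (_+_ s) (certsL 1 0 ts)) (s + k) ≡⟨ occ-map-+ s (certsL 1 0 ts) k ⟩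
      occ (certsL 1 0 ts) k ∎

-- The leftmost internal child of the root

-- Counting certificates of C and its descendants, P of the subtree C is
-- X d Y, the extra d being the certificate of C itself, while P(Π C) = X Y.
record ChildSplit (c : DTree) (cs : List DTree) : Set where
  constructor mkChildSplit
  field
    X Y : Path
    P-split : Pw (occ (certs 1 0 (node c cs))) 0 (node c cs) ≡ X ++ d ∷ Y
    PΠ-split : X ++ Y ≡ Pw (certCount (decr (node c cs))) 0 (decr (node c cs))
    X-balanced : height 0 X ≡ just 0
    length-XY : length X + length Y ≡ length (Qw (node c cs))
    contacts-Y-fl : suc (contactsFrom 0 Y) ≡ fl (node (node c cs) [])

module ChildSplitting (c : DTree) (cs : List DTree) (v : ValidNode 1 (node c cs))
                      (c30 : Cond3 (+ 0) (leaves (node c cs))) where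
  C : DTree
  C = node c cs
  Ls : List ℤ
  Ls = leaves C
  n : ℕ
  n = nleaves C
  vc : ValidChild 1 c
  vc = proj₁ v
  vcs : ValidChildren 1 cs
  vcs = proj₁ (proj₂ v)
  c3s : All (λ ch → Cond3 (+ 1) (leaves ch)) (c ∷ cs)
  c3s = proj₂ (proj₂ (proj₂ v))
  certificate : Σ ℕ (λ k → firstLe ((+ 1) ℤ.- (+ 2)) Ls ≡ just k)
  certificate = firstLe-any ((+ 1) ℤ.- (+ 2)) Ls (proj₁ (proj₂ (proj₂ v)))
  k₀ : ℕ
  k₀ = proj₁ certificate
  k-certifies : firstLe ((+ 1) ℤ.- (+ 2)) Ls ≡ just k₀
  k-certifies = proj₂ certificate
  k<n : k₀ < n
  k<n = firstLe-bound _ Ls k₀ k-certifies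
  k1 m : ℕ
  k1 = k₀ + 1
  m = n ∸ k1
  n≡ : k1 + m ≡ n
  n≡ = NP.m+[n∸m]≡n (subst (_≤ n) (+-comm 1 k₀) k<n)
  spansC : List (ℕ × ℕ)
  spansC = spansL 2 0 (c ∷ cs)
  certsC : List ℕ
  certsC = certsL 2 0 (c ∷ cs)
  g f f' H : ℕ → ℕ
  g = occ (firstLeavesL 0 (c ∷ cs))
  f = occ certsC
  f' = occ (k₀ ∷ certsC)
  H = straddling spansC
  X Y : Path
  X = blocks g f 0 k1
  Y = blocks g f k1 m

  certs-C : certs 1 0 C ≡ k₀ ∷ certsC
  certs-C rewrite k-certifies = refl

  spansC-ordered : All Ordered spansC
  spansC-ordered = All.map (λ p → proj₁ (proj₂ p)) (spansL-range 2 0 (c ∷ cs))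

  profile : ∀ o n' → IsProfile H g f o n'
  profile o n' j _ _ = subst₂ (λ A B → H j + occ A j ≡ H (suc j) + occ B j)
               (spansL-proj₁ 1 0 (c ∷ cs) (vc , vcs)) (spansL-proj₂ 2 0 (c ∷ cs)) (straddling-step spansC j spansC-ordered)

  P-blocks : Pw f 0 C ≡ blocks g f 0 n
  P-blocks = PwL-blocks f 0 (c ∷ cs)

  blocks-split : blocks g f 0 n ≡ X ++ Y
  blocks-split = subst (λ z → blocks g f 0 z ≡ X ++ Y) n≡ (blocks-++ g f 0 k1 m)

  blocks-split-bumped : blocks g f' 0 n ≡ X ++ d ∷ Y
  blocks-split-bumped = begin
      blocks g f' 0 n ≡⟨ cong (blocks g f' 0) (sym n≡) ⟩
      blocks g f' 0 (k1 + m) ≡⟨ blocks-++ g f' 0 k1 m ⟩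
      blocks g f' 0 k1 ++ blocks g f' k1 m
        ≡⟨ cong₂ _++_ (blocks-last-bump g f f' 0 k₀ (λ j _ lt → occ-∷-≢ k₀ certsC j (λ e → NP.<-irrefl (sym e) lt)) (occ-∷-≡ k₀ certsC))
                      (blocks-cong g g f' f k1 m (λ _ _ _ → refl)
                         (λ j le _ → occ-∷-≢ k₀ certsC j (λ e → NP.<-irrefl e (subst (_≤ j) (+-comm k₀ 1) le)))) ⟩
      (X ++ d ∷ []) ++ Y ≡⟨ ++-assoc X (d ∷ []) Y ⟩
      X ++ d ∷ Y ∎
    where open ≡-Reasoning

  P-split : Pw (occ (certs 1 0 C)) 0 C ≡ X ++ d ∷ Y
  P-split = trans (cong (λ L → Pw (occ L) 0 C) certs-C) (trans (PwL-blocks f' 0 (c ∷ cs)) blocks-split-bumped)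

  certs-ΠC : allCerts (decr C) ≡ certsC
  certs-ΠC = sym (cong₂ _++_ (certs-decr 0 0 c)
           (trans (certsL-decr 0 (nleaves c) cs) (cong (λ z → certsL 1 z (decrL cs)) (sym (nleaves-decr c)))))

  PΠ-split : X ++ Y ≡ Pw (certCount (decr C)) 0 (decr C)
  PΠ-split = sym (begin
      Pw (occ (allCerts (decr C))) 0 (decr C) ≡⟨ cong (λ L → Pw (occ L) 0 (decr C)) certs-ΠC ⟩
      Pw f 0 (decr C) ≡⟨ Pw-decr f 0 C ⟩
      Pw f 0 C ≡⟨ P-blocks ⟩
      blocks g f 0 n ≡⟨ blocks-split ⟩
      X ++ Y ∎)
    where open ≡-Reasoning

  label-k≤-1 : at Ls k₀ ℤ.≤ -1ℤ
  label-k≤-1 = firstLe-hit _ Ls k₀ k-certifies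

  H0 : H 0 ≡ 0
  H0 = straddling-zero spansC

  Hk : H (suc k₀) ≡ 0
  Hk = length-filter-none (straddles? (suc k₀)) (spansL-avoid 1 0 (c ∷ cs) k₀ (vc , vcs) k<n (≤-1⇒<1 _ label-k≤-1))

  Hk1 : H k1 ≡ 0
  Hk1 = trans (cong H (+-comm k₀ 1)) Hk

  X-balanced : height 0 X ≡ just 0
  X-balanced = begin
      height 0 X ≡⟨ cong₂ height (sym H0) (sym (++-identityʳ X)) ⟩
      height (H 0) (X ++ []) ≡⟨ height-blocks H g f 0 k1 [] (profile 0 k1) ⟩
      just (H k1) ≡⟨ cong just Hk1 ⟩
      just 0 ∎
    where open ≡-Reasoning

  Hn : H n ≡ 0
  Hn = length-filter-none (straddles? n) (All.map (λ {pr} p → ¬straddles-below n pr (proj₂ (proj₂ p))) (spansL-range 2 0 (c ∷ cs)))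

  XY-balanced : height 0 (X ++ Y) ≡ just 0
  XY-balanced = begin
      height 0 (X ++ Y) ≡⟨ cong₂ height (sym H0) (trans (sym blocks-split) (sym (++-identityʳ _))) ⟩
      height (H 0) (blocks g f 0 n ++ []) ≡⟨ height-blocks H g f 0 n [] (profile 0 n) ⟩
      just (H n) ≡⟨ cong just Hn ⟩
      just 0 ∎
    where open ≡-Reasoning

  ups-XY : ups (X ++ Y) ≡ ups (Qw C)
  ups-XY = trans (cong ups (trans (sym blocks-split) (sym P-blocks))) (ups-Pw f 0 C)

  length-XY : length X + length Y ≡ length (Qw C)
  length-XY = begin
      length X + length Y ≡⟨ sym (length-++ X) ⟩
      length (X ++ Y) ≡⟨ sym (NP.+-identityʳ _) ⟩
      length (X ++ Y) + 0 ≡⟨ length-by-height 0 (X ++ Y) 0 XY-balanced ⟩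
      ups (X ++ Y) + ups (X ++ Y) + 0 ≡⟨ cong (λ z → z + z + 0) ups-XY ⟩
      ups (Qw C) + ups (Qw C) + 0 ≡⟨ sym (length-by-height 0 (Qw C) 0 (height-Qw 0 C)) ⟩
      length (Qw C) + 0 ≡⟨ NP.+-identityʳ _ ⟩
      length (Qw C) ∎
    where open ≡-Reasoning

  0≤⇒≰-1 : ∀ l → + 0 ℤ.≤ l → ¬ (l ℤ.≤ -1ℤ)
  0≤⇒≰-1 (+ k) p ()

  -- Free leaves are straddled by no span and positive labels by some span,
  -- while a label 0 after the free leaf k₀ would violate condition 3 at the root.
  ground-after : ∀ j → k1 ≤ j → j < n → isGround (H (suc j)) ≡ indicator (at Ls j ℤ.≟ -1ℤ)
  ground-after j le j<n with at Ls j in eql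
  ... | -[1+ zero ] = trans (cong isGround (length-filter-none (straddles? (suc j))
                              (spansL-avoid 1 0 (c ∷ cs) j (vc , vcs) j<n (subst (ℤ._< + 1) (sym eql) ℤ.-<+))))
                            (sym (indicator-yes (-1ℤ ℤ.≟ -1ℤ) refl))
  ... | -[1+ suc k ] with subst (-1ℤ ℤ.≤_) eql (All⇒at Ls j (labels≥-1 0 C v) j<n)
  ...   | ℤ.-≤- ()
  ground-after j le j<n | + zero = ⊥-elim (0≤⇒≰-1 (at Ls k₀)
      (All-take⇒at Ls j k₀ (c30 (take j Ls) (drop (suc j) Ls)
           (subst (λ z → Ls ≡ take j Ls ++ z ∷ drop (suc j) Ls) eql (split-at Ls j j<n)))
         (subst (_≤ j) (+-comm k₀ 1) le) k<n) label-k≤-1)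
  ground-after j le j<n | + suc q =
    trans (isGround-pos _ (filter-some (straddles? (suc j)) (spansL-cover 1 0 (c ∷ cs) j (suc q) (vc , vcs) c3s j<n eql (s≤s z≤n))))
          (sym (indicator-no (+ suc q ℤ.≟ -1ℤ) (λ ())))

  free? : Decidable (_≡ -1ℤ)
  free? l = l ℤ.≟ -1ℤ

  contacts-Y : contactsFrom 0 Y ≡ length (filter free? (drop k1 Ls))
  contacts-Y = begin
      contactsFrom 0 Y ≡⟨ cong₂ contactsFrom (sym Hk1) (sym (++-identityʳ Y)) ⟩
      contactsFrom (H k1) (Y ++ []) ≡⟨ contactsFrom-blocks H g f k1 m [] (profile k1 m) ⟩
      sumFrom (λ j → isGround (H (suc j))) k1 m + 0 ≡⟨ NP.+-identityʳ _ ⟩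
      sumFrom (λ j → isGround (H (suc j))) k1 m ≡⟨ sumFrom-cong _ _ k1 m (λ j a b → ground-after j a (subst (j <_) n≡ b)) ⟩
      sumFrom (λ j → indicator (at Ls j ℤ.≟ -1ℤ)) k1 (length Ls ∸ k1) ≡⟨ sumFrom-at (λ l → indicator (l ℤ.≟ -1ℤ)) Ls k1 ⟩
      sumList (λ l → indicator (l ℤ.≟ -1ℤ)) (drop k1 Ls) ≡⟨ sumList-indicator free? (drop k1 Ls) ⟩
      length (filter free? (drop k1 Ls)) ∎
    where open ≡-Reasoning

  label-k : at Ls k₀ ≡ -1ℤ
  label-k = ℤP.≤-antisym label-k≤-1 (All⇒at Ls k₀ (labels≥-1 0 C v) k<n)

  no-free-before-k : length (filter free? (take k₀ Ls)) ≡ 0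
  no-free-before-k = length-filter-none free? (at⇒All-take Ls k₀ (λ i lt _ e → firstLe-before _ Ls k₀ i k-certifies lt (subst (ℤ._≤ -1ℤ) (sym e) (ℤ.-≤- z≤n))))

  fl-C : fl (node C []) ≡ suc (length (filter free? (drop k1 Ls)))
  fl-C = begin
      length (filter free? (Ls ++ [])) ≡⟨ cong (λ z → length (filter free? z)) (++-identityʳ Ls) ⟩
      length (filter free? Ls) ≡⟨ cong (λ z → length (filter free? z)) (split-at Ls k₀ k<n) ⟩
      length (filter free? (take k₀ Ls ++ at Ls k₀ ∷ drop (suc k₀) Ls)) ≡⟨ length-filter-++ free? (take k₀ Ls) _ ⟩
      length (filter free? (take k₀ Ls)) + length (filter free? (at Ls k₀ ∷ drop (suc k₀) Ls))
        ≡⟨ cong₂ _+_ no-free-before-k (length-filter-∷ free? (at Ls k₀) _) ⟩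
      indicator (free? (at Ls k₀)) + length (filter free? (drop (suc k₀) Ls))
        ≡⟨ cong₂ _+_ (indicator-yes (free? (at Ls k₀)) label-k) (cong (λ z → length (filter free? (drop z Ls))) (+-comm 1 k₀)) ⟩
      suc (length (filter free? (drop k1 Ls))) ∎
    where open ≡-Reasoning

  contacts-Y-fl : suc (contactsFrom 0 Y) ≡ fl (node C [])
  contacts-Y-fl = trans (cong suc contacts-Y) (sym fl-C)

childSplit : ∀ c cs → ValidNode 1 (node c cs) → Cond3 (+ 0) (leaves (node c cs)) → ChildSplit c cs
childSplit c cs v c30 = mkChildSplit X Y P-split PΠ-split X-balanced length-XY contacts-Y-fl
  where open ChildSplitting c cs v c30

module RootWithInternalLeftChild (c₁ : DTree) (cs rest : List DTree) (v : ValidNode 0 (node (node c₁ cs) rest)) where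
  C T : DTree
  C = node c₁ cs
  T = node C rest
  C-valid : ValidNode 1 C
  C-valid = proj₁ v
  C-cond3 : Cond3 (+ 0) (leaves C)
  C-cond3 = All.head (proj₂ (proj₂ (proj₂ v)))
  open ChildSplit (childSplit c₁ cs C-valid C-cond3) public
  f : ℕ → ℕ
  f = certCount T
  P Prest : Path
  P = Pw f 0 T
  Prest = PwL f (nleaves C) rest

  P-C : Pw f 0 C ≡ Pw (occ (certs 1 0 C)) 0 C
  P-C = Pw-cong _ _ 0 C (λ j _ lt → trans (occ-++ (certs 1 0 C) _ j)
            (trans (cong (λ z → occ (certs 1 0 C) j + z)
                     (occ-below (certsL 1 (nleaves C) rest) j (nleaves C) (inRange-lower (certsL-range 1 (nleaves C) rest)) lt))
                   (NP.+-identityʳ _)))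

  P-tail : drop 1 P ≡ X ++ d ∷ (Y ++ Prest)
  P-tail = trans (cong (_++ Prest) (trans P-C P-split)) (++-assoc X (d ∷ Y) Prest)

  br-P : br 0 (drop 1 P) ≡ (X , Y ++ Prest)
  br-P = trans (cong (br 0) P-tail) (br-balanced 0 X (Y ++ Prest) X-balanced)

  length-Y : length (Qw C) ∸ length X ≡ length Y
  length-Y = trans (cong (_∸ length X) (sym length-XY)) (NP.m+n∸m≡n (length X) (length Y))

  take-Y : take (length (Qw C) ∸ length X) (Y ++ Prest) ≡ Y
  take-Y = trans (cong (λ z → take z (Y ++ Prest)) length-Y) (take-length-++ Y Prest)

  drop-Y : drop (length (Qw C) ∸ length X) (Y ++ Prest) ≡ Prest
  drop-Y = trans (cong (λ z → drop z (Y ++ Prest)) length-Y) (drop-length-++ Y Prest)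

  Qs : Path
  Qs = Qw C ++ d ∷ QwL rest

  φI∘I-T : φI (I T) ≡ φI-step (length Qs) P X (Y ++ Prest) (Qw C) (QwL rest)
  φI∘I-T = trans (φI-at P (Qw T) Qs (Qw-node C rest))
          (trans (φI-unfold (length Qs) P Qs (Qw C) (QwL rest) (br-balanced 0 (Qw C) (QwL rest) (height-Qw 0 C)))
            (cong₂ (λ A B → φI-step (length Qs) P A B (Qw C) (QwL rest)) (cong proj₁ br-P) (cong proj₂ br-P)))

  length-QC : length (Qw C) ≤ length Qs
  length-QC = subst (length (Qw C) ≤_) (sym (length-++ (Qw C))) (NP.m≤m+n _ _)

  length-Qrest : length (QwL rest) ≤ length Qs
  length-Qrest = subst (length (QwL rest) ≤_) (sym (length-++ (Qw C))) (NP.≤-trans (NP.n≤1+n _) (NP.m≤n+m (length (d ∷ QwL rest)) (length (Qw C))))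

  φI-head : φI-fuel (length Qs) (X ++ take (length (Qw C) ∸ length X) (Y ++ Prest)) (Qw C) ≡ φI (I (decr C))
  φI-head = begin
      φI-fuel (length Qs) (X ++ take (length (Qw C) ∸ length X) (Y ++ Prest)) (Qw C)
        ≡⟨ cong (λ z → φI-fuel (length Qs) (X ++ z) (Qw C)) take-Y ⟩
      φI-fuel (length Qs) (X ++ Y) (Qw C) ≡⟨ cong (λ z → φI-fuel (length Qs) z (Qw C)) PΠ-split ⟩
      φI-fuel (length Qs) PΠ (Qw C) ≡⟨ φI-fuel-irrelevant _ _ PΠ (Qw C) length-QC NP.≤-refl ⟩
      φI-fuel (length (Qw C)) PΠ (Qw C) ≡⟨ cong (λ z → φI-fuel (length z) PΠ z) (sym (Qw-decr C)) ⟩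
      φI (I (decr C)) ∎
    where open ≡-Reasoning
          PΠ : Path
          PΠ = Pw (certCount (decr C)) 0 (decr C)

φI∘I-leaf-first : ∀ l x xs → φI (I (node (leaf l) (x ∷ xs))) ≡ L (φI (I (node x xs)))
φI∘I-leaf-first l x xs =
  trans (φI-unfold (suc (length Q)) P (d ∷ Q) [] Q refl) (cong L (begin
    φI-fuel (suc (length Q)) (drop 2 P) Q      ≡⟨ cong (λ z → φI-fuel (suc (length Q)) z Q) drop-P ⟩
    φI-fuel (suc (length Q)) (Pw g 0 (node x xs)) Q ≡⟨ φI-fuel-irrelevant _ _ _ Q (NP.n≤1+n _) NP.≤-refl ⟩
    φI (I (node x xs)) ∎))
  where
    open ≡-Reasoning
    T : DTree
    T = node (leaf l) (x ∷ xs)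
    Q : Path
    Q = QwL (x ∷ xs)
    P : Path
    P = Pw (certCount T) 0 T
    g : ℕ → ℕ
    g = certCount (node x xs)
    uncertified : certCount T 0 ≡ 0
    uncertified = occ-below (certsL 1 1 (x ∷ xs)) 0 1 (inRange-lower (certsL-range 1 1 (x ∷ xs))) (s≤s z≤n)
    drop-P : drop 2 P ≡ Pw g 0 (node x xs)
    drop-P = trans (cong (λ z → replicate z d ++ PwL (certCount T) 1 (x ∷ xs)) uncertified)
                   (PwL-restrict [] 1 (x ∷ xs) [])

φI∘I-single-child : ∀ c₁ cs → IsDecorated (node (node c₁ cs) []) →
  φI (I (node (node c₁ cs) [])) ≡ Δ (φI (I (decr (node c₁ cs)))) (fl (node (node c₁ cs) []))
φI∘I-single-child c₁ cs v = trans φI∘I-T (cong₂ Δ φI-head contacts-P)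
  where
    open RootWithInternalLeftChild c₁ cs [] v
    open ≡-Reasoning
    contacts-P : c P ≡ fl T
    contacts-P = begin
      contactsFrom 1 (drop 1 P)                ≡⟨ cong (contactsFrom 1) P-tail ⟩
      contactsFrom 1 (X ++ d ∷ (Y ++ []))      ≡⟨ contactsFrom-++ 1 X (d ∷ (Y ++ [])) 1 (height-lift 0 X 0 X-balanced) ⟩
      contactsFrom 1 X + suc (contactsFrom 0 (Y ++ []))
        ≡⟨ cong₂ (λ a b → a + suc (contactsFrom 0 b)) (contactsFrom-lift 0 X 0 X-balanced) (++-identityʳ Y) ⟩
      suc (contactsFrom 0 Y)                   ≡⟨ contacts-Y-fl ⟩
      fl T ∎

φI∘I-internal-first : ∀ c₁ cs x xs → IsDecorated (node (node c₁ cs) (x ∷ xs)) →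
  φI (I (node (node c₁ cs) (x ∷ xs))) ≡ ⊕ (φI (I (decr (node c₁ cs)))) (fl (node (node c₁ cs) [])) (φI (I (node x xs)))
φI∘I-internal-first c₁ cs x xs v = trans φI∘I-T (cong₃ ⊕ φI-head label tail)
  where
    open RootWithInternalLeftChild c₁ cs (x ∷ xs) v
    k : ℕ
    k = length (Qw C) ∸ length X
    cong₃ : ∀ (h : BTree → ℕ → BTree → BTree) {a a' i i' b b'} → a ≡ a' → i ≡ i' → b ≡ b' → h a i b ≡ h a' i' b'
    cong₃ h refl refl refl = refl
    label : 1 + c (take k (Y ++ Prest)) ≡ fl (node C [])
    label = trans (cong (λ z → 1 + c z) take-Y) contacts-Y-fl
    tail : φI-fuel (length Qs) (drop k (Y ++ Prest)) (QwL (x ∷ xs)) ≡ φI (I (node x xs))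
    tail = trans (cong (λ z → φI-fuel (length Qs) z (QwL (x ∷ xs)))
                   (trans drop-Y (PwL-restrict (certs 1 0 C) (nleaves C) (x ∷ xs) (inRange-upper (certs-range 1 0 C)))))
                 (φI-fuel-irrelevant _ _ _ (QwL (x ∷ xs)) length-Qrest NP.≤-refl)

tail-decorated : ∀ y x xs → IsDecorated (node y (x ∷ xs)) → IsDecorated (node x xs)
tail-decorated y x xs (_ , (vx , vxs) , _ , (_ ∷ c3s)) = vx , vxs , tt , c3s

Π-decorated : ∀ c cs rest → IsDecorated (node (node c cs) rest) → IsDecorated (decr (node c cs))
Π-decorated c cs rest v = ValidNode-decr 0 c cs (proj₁ v)

φT≡φI∘I-bounded : ∀ N T → size T ≤ N → IsDecorated T → φT T ≡ φI (I T)
φT≡φI∘I-bounded N (leaf _) _ ()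
φT≡φI∘I-bounded zero (node _ _) () _
φT≡φI∘I-bounded (suc N) (node (leaf l) []) _ _ = refl
φT≡φI∘I-bounded (suc N) (node (leaf l) (x ∷ xs)) (s≤s le) v =
  trans (cong L (φT≡φI∘I-bounded N (node x xs) le (tail-decorated (leaf l) x xs v)))
        (sym (φI∘I-leaf-first l x xs))
φT≡φI∘I-bounded (suc N) (node (node c cs) []) (s≤s le) v = begin
    φT (node C [])                 ≡⟨ φT-single-child c cs ⟩
    Δ (φT (decr C)) (fl (node C []))
      ≡⟨ cong (λ B → Δ B (fl (node C []))) (φT≡φI∘I-bounded N (decr C) (decr-head-bound c cs [] le) (Π-decorated c cs [] v)) ⟩
    Δ (φI (I (decr C))) (fl (node C [])) ≡⟨ sym (φI∘I-single-child c cs v) ⟩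
    φI (I (node C [])) ∎
  where open ≡-Reasoning
        C : DTree
        C = node c cs
φT≡φI∘I-bounded (suc N) (node (node c cs) (x ∷ xs)) (s≤s le) v = begin
    φT (node C (x ∷ xs))                            ≡⟨ φT-internal-first c cs x xs ⟩
    ⊕ (φT (decr C)) (fl (node C [])) (φT (node x xs))
      ≡⟨ cong₂ (λ A B → ⊕ A (fl (node C [])) B)
           (φT≡φI∘I-bounded N (decr C) (decr-head-bound c cs (x ∷ xs) le) (Π-decorated c cs (x ∷ xs) v))
           (φT≡φI∘I-bounded N (node x xs) (tail-bound C x xs le) (tail-decorated C x xs v)) ⟩
    ⊕ (φI (I (decr C))) (fl (node C [])) (φI (I (node x xs))) ≡⟨ sym (φI∘I-internal-first c cs x xs v) ⟩
    φI (I (node C (x ∷ xs))) ∎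
  where open ≡-Reasoning
        C : DTree
        C = node c cs

theorem3p7 : (T : DTree) → IsDecorated T → φT T ≡ φI (I T)
theorem3p7 T v = φT≡φI∘I-bounded (size T) T NP.≤-refl v
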